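{- Let $\mathcal L\in\{\mathsf{FO}(<),\mathsf{FO}(<,\equiv),\mathsf{FO}(<,\mathsf{MOD})\}$ and let $\Sigma,\Gamma,\Delta$ be alphabets such that $\Sigma\cup\{x,y\}\subseteq\Gamma\subseteq\Delta$ for some symbols $x,y\notin\Sigma$. Then a regular language $L$ over $\Sigma$ is $\mathcal L$-definable if and only if the regular language $L'=\{w_1xwyw_2\mid w\in L,\ w_1,w_2\in\Gamma^\ast\}$ is $\mathcal L$-definable over $\Delta$.
   Context: A word $a_0\dots a_{n-1}$ over an alphabet $\Sigma$ is regarded as the first-order structure with domain $\{0,\dots,n-1\}$, the natural order $<$ and a unary predicate $P_a=\{i\mid a_i=a\}$ for each $a\in\Sigma$. $\mathsf{FO}(<)$ is first-order logic over this signature; $\mathsf{FO}(<,\equiv)$ additionally has, for each $n\ge 1$, the unary predicate $x\equiv 0 \pmod n$; $\mathsf{FO}(<,\mathsf{MOD})$ additionally has, for each $n\ge1$, the modular quantifier $\exists^n x\,\psi$, true iff the number of positions satisfying $\psi$ is divisible by $n$. A language over an alphabet is $\mathcal L$-definable (over that alphabet) if there is an $\mathcal L$-sentence true in exactly the words of the language. -}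

module Defs where

open import Data.Nat using (ℕ; zero; suc; _≤_)
open import Data.Nat.Divisibility using (_∣?_)
open import Data.Fin using (Fin; toℕ) renaming (zero to fz; suc to fs)
open import Data.Bool using (Bool; true; false; not; _∧_; _∨_; if_then_else_)
open import Data.List using (List; []; _∷_; _++_; [_]; length; map; allFin)
open import Data.Bool.ListAction using (any)
open import Data.Product using (Σ; ∃; ∃-syntax; _×_; _,_)
open import Function.Bundles using (_⇔_)
open import Relation.Nullary.Decidable using (⌊_⌋)
open import Relation.Binary.PropositionalEquality using (_≡_)
open import Data.Fin using (_≟_)

data Logic : Set where
  FO[<]     : Logic
  FO[<,≡]   : Logic
  FO[<,MOD] : Logic

data HasCong : Logic → Set where
  cong-≡ : HasCong FO[<,≡]

data HasModQ : Logic → Set where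
  modq : HasModQ FO[<,MOD]

data Formula (ℒ : Logic) (A : Set) : ℕ → Set where
  letter : ∀ {n} → A → Fin n → Formula ℒ A n
  _<′_   : ∀ {n} → Fin n → Fin n → Formula ℒ A n
  _=′_   : ∀ {n} → Fin n → Fin n → Formula ℒ A n
  ⊤′     : ∀ {n} → Formula ℒ A n
  ¬′_    : ∀ {n} → Formula ℒ A n → Formula ℒ A n
  _∧′_   : ∀ {n} → Formula ℒ A n → Formula ℒ A n → Formula ℒ A n
  ∃′_    : ∀ {n} → Formula ℒ A (suc n) → Formula ℒ A n  -- binds variable fz
  cong0  : ∀ {n} → HasCong ℒ → (m : ℕ) → 1 ≤ m → Fin n → Formula ℒ A n
  ∃^     : ∀ {n} → HasModQ ℒ → (m : ℕ) → 1 ≤ m → Formula ℒ A (suc n) → Formula ℒ A n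

Sentence : Logic → Set → Set
Sentence ℒ A = Formula ℒ A 0

module _ {A : Set} (_≟A_ : (a b : A) → Relation.Nullary.Decidable.Dec (a ≡ b)) where

  open import Data.List using (lookup)

  countTrue : List Bool → ℕ
  countTrue []           = 0
  countTrue (true ∷ bs)  = suc (countTrue bs)
  countTrue (false ∷ bs) = countTrue bs

  _<ᵇ_ : ℕ → ℕ → Bool
  m <ᵇ n = Data.Nat._<ᵇ_ m n

  extend : ∀ {n} {B : Set} → B → (Fin n → B) → Fin (suc n) → B
  extend b v fz     = b
  extend b v (fs i) = v i

  eval : ∀ {ℒ n} (w : List A) → Formula ℒ A n → (Fin n → Fin (length w)) → Bool
  eval w (letter a x) v  = ⌊ lookup w (v x) ≟A a ⌋
  eval w (x <′ y) v      = toℕ (v x) <ᵇ toℕ (v y)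
  eval w (x =′ y) v      = ⌊ v x ≟ v y ⌋
  eval w ⊤′ v            = true
  eval w (¬′ φ) v        = not (eval w φ v)
  eval w (φ ∧′ ψ) v      = eval w φ v ∧ eval w ψ v
  eval w (∃′ φ) v        = any (λ i → eval w φ (extend i v)) (allFin (length w))
  eval w (cong0 _ m _ x) v = ⌊ m ∣? toℕ (v x) ⌋
  eval w (∃^ _ m _ φ) v  =
    ⌊ m ∣? countTrue (map (λ i → eval w φ (extend i v)) (allFin (length w))) ⌋

  _⊨_ : ∀ {ℒ} → List A → Sentence ℒ A → Bool
  w ⊨ φ = eval w φ (λ ())

Language : ℕ → Set₁
Language k = List (Fin k) → Set

Definable : Logic → (k : ℕ) → Language k → Set
Definable ℒ k L = Σ (Sentence ℒ (Fin k)) λ φ → ∀ w → L w ⇔ (_⊨_ _≟_ w φ ≡ true)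

record DFA (k : ℕ) : Set where
  field
    states    : ℕ
    init      : Fin states
    δ         : Fin states → Fin k → Fin states
    accepting : Fin states → Bool

  run : Fin states → List (Fin k) → Fin states
  run q []      = q
  run q (a ∷ w) = run (δ q a) w

  accepts : List (Fin k) → Bool
  accepts w = accepting (run init w)

Regular : (k : ℕ) → Language k → Set
Regular k L = Σ (DFA k) λ M → ∀ w → L w ⇔ (DFA.accepts M w ≡ true)

-- L' = { w₁ x w y w₂ | w ∈ L, w₁ , w₂ ∈ Γ* } ⊆ Δ*, where Σ ↪ Γ ↪ Δ via ι, κ

L′ : {s g d : ℕ} → (Fin s → Fin g) → (Fin g → Fin d) → Fin g → Fin g
   → Language s → Language d
L′ ι κ x y L u =
  ∃[ w₁ ] ∃[ w ] ∃[ w₂ ]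
    (L w × u ≡ map κ (w₁ ++ [ x ] ++ map ι w ++ [ y ] ++ w₂))

-- (⇒) If φ defines L, a Δ-sentence for L′ says: every letter is in Γ, and some
-- x-position i and y-position j > i enclose only Σ-letters such that φ,
-- relativised to the positions strictly between i and j, holds.  Quantifiers,
-- modular ones included, relativise by guarding; a congruence predicate on a
-- position v of the factor becomes m ∣ v − (i + 1), which is expressible by
-- guessing the residue of i + 1 modulo m.
--
-- (⇐) If ψ defines L′, then w ∈ L iff x·w·y ⊨ ψ, because x, y ∉ Σ force any
-- decomposition of x·w·y as in L′ to be the trivial one.  So it suffices to
-- translate ψ into a Σ-sentence evaluated on w: every variable of ψ sits on x,
-- on y, or on a position of w, shifted by one.  A modular count over x·w·y
-- exceeds the count over w by the number e ≤ 2 of markers satisfying the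
-- body, and FO(<,MOD) can still test m ∣ count + e.

module Submission where

open import Defs hiding (_<ᵇ_)
open import Data.Bool using (Bool; true; false; not; _∧_; _∨_; if_then_else_; T)
open import Data.Bool.ListAction using (any)
open import Data.Bool.Properties using (∨-assoc; ∨-comm; ∨-identityʳ)
open import Data.Empty using (⊥; ⊥-elim)
open import Data.Fin using (Fin; toℕ; _≟_) renaming (zero to fz; suc to fs)
open import Data.Fin.Properties using (toℕ-injective; any?)
open import Data.List using (List; []; _∷_; _++_; [_]; length; map; lookup; tabulate)
open import Data.List.Properties using (length-++; length-map; map-++; map-∘; map-injective; ∷-injectiveˡ; ∷-injectiveʳ)
open import Data.Nat using (ℕ; zero; suc; _+_; _*_; _∸_; _≤_; _<_; _≤?_; z≤n; s≤s; z<s; s<s; _<ᵇ_; _≡ᵇ_)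
open import Data.Nat.Divisibility using (_∣_; _∣?_; ∣m+n∣m⇒∣n; ∣m∣n⇒∣m+n; n∣m*n; m∣m*n; _∣0; ∣-refl)
open import Data.Nat.DivMod using (_%_; _/_; m≡m%n+[m/n]*n; m%n<n; m/n*n≤m)
open import Data.Nat.Properties hiding (_≟_)
open import Data.Product using (∃-syntax; _×_; _,_; proj₁; proj₂)
open import Data.Sum using (_⊎_; inj₁; inj₂)
open import Data.Unit using (tt)
open import Function using (_∘_; id)
open import Function.Bundles using (_⇔_; mk⇔; Equivalence)
open import Function.Definitions using (Injective)
open import Function.Properties.Equivalence using () renaming (sym to ⇔-sym; trans to ⇔-trans)
open import Relation.Binary.PropositionalEquality hiding ([_])
open import Relation.Nullary using (Dec; yes; no)
open import Relation.Nullary.Decidable using (⌊_⌋)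

open Equivalence using (to; from)
open ≡-Reasoning

toWitnessᵇ : ∀ {P : Set} (d : Dec P) → ⌊ d ⌋ ≡ true → P
toWitnessᵇ (yes p) _ = p

fromWitnessᵇ : ∀ {P : Set} (d : Dec P) → P → ⌊ d ⌋ ≡ true
fromWitnessᵇ (yes p) _ = refl
fromWitnessᵇ (no ¬p) p = ⊥-elim (¬p p)

truth-ext : ∀ {b c : Bool} → (b ≡ true → c ≡ true) → (c ≡ true → b ≡ true) → b ≡ c
truth-ext {true}  {true}  f g = refl
truth-ext {true}  {false} f g = sym (f refl)
truth-ext {false} {true}  f g = g refl
truth-ext {false} {false} f g = refl

⌊⌋-⇔ : ∀ {P Q : Set} (p : Dec P) (q : Dec Q) → P ⇔ Q → ⌊ p ⌋ ≡ ⌊ q ⌋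
⌊⌋-⇔ p q P⇔Q = truth-ext (fromWitnessᵇ q ∘ to P⇔Q ∘ toWitnessᵇ p) (fromWitnessᵇ p ∘ from P⇔Q ∘ toWitnessᵇ q)

≡⌊⌋ : ∀ {P : Set} {b} (d : Dec P) → b ≡ true ⇔ P → b ≡ ⌊ d ⌋
≡⌊⌋ d b⇔P = truth-ext (fromWitnessᵇ d ∘ to b⇔P) (from b⇔P ∘ toWitnessᵇ d)

∧-elimˡ : ∀ {a b} → a ∧ b ≡ true → a ≡ true
∧-elimˡ {true} _ = refl

∧-elimʳ : ∀ {a b} → a ∧ b ≡ true → b ≡ true
∧-elimʳ {true} e = e

∧-intro : ∀ {a b} → a ≡ true → b ≡ true → a ∧ b ≡ true
∧-intro refl refl = refl

∨-elim : ∀ {a b} → a ∨ b ≡ true → a ≡ true ⊎ b ≡ true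
∨-elim {true}  _ = inj₁ refl
∨-elim {false} e = inj₂ e

∨-introˡ : ∀ {a b} → a ≡ true → a ∨ b ≡ true
∨-introˡ refl = refl

∨-introʳ : ∀ {a b} → b ≡ true → a ∨ b ≡ true
∨-introʳ {true}  _ = refl
∨-introʳ {false} e = e

not-elim : ∀ {a} → not a ≡ true → a ≡ true → ⊥
not-elim {true} ()

not-intro : ∀ {a} → (a ≡ true → ⊥) → not a ≡ true
not-intro {true}  f = ⊥-elim (f refl)
not-intro {false} f = refl

<ᵇ≡true⇒< : ∀ {m n} → (m <ᵇ n) ≡ true → m < n
<ᵇ≡true⇒< {m} {n} e = <ᵇ⇒< m n (subst T (sym e) tt)

<⇒<ᵇ≡true : ∀ {m n} → m < n → (m <ᵇ n) ≡ true
<⇒<ᵇ≡true {m} {n} p with m <ᵇ n | <⇒<ᵇ p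
... | true | _ = refl

≤⇒<ᵇ≡false : ∀ {m n} → n ≤ m → (m <ᵇ n) ≡ false
≤⇒<ᵇ≡false {m} {n} n≤m with m <ᵇ n in eq
... | false = refl
... | true  = ⊥-elim (<⇒≱ (<ᵇ≡true⇒< eq) n≤m)

≡ᵇ-refl : ∀ n → (n ≡ᵇ n) ≡ true
≡ᵇ-refl zero    = refl
≡ᵇ-refl (suc n) = ≡ᵇ-refl n

≢⇒≡ᵇ≡false : ∀ {m n} → m ≢ n → (m ≡ᵇ n) ≡ false
≢⇒≡ᵇ≡false {m} {n} m≢n with m ≡ᵇ n in eq
... | false = refl
... | true  = ⊥-elim (m≢n (≡ᵇ⇒≡ m n (subst T (sym eq) tt)))

≡ᵇ≡true⇒≡ : ∀ {m n} → (m ≡ᵇ n) ≡ true → m ≡ n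
≡ᵇ≡true⇒≡ {m} {n} e = ≡ᵇ⇒≡ m n (subst T (sym e) tt)

≡⇒≡ᵇ≡true : ∀ {m n} → m ≡ n → (m ≡ᵇ n) ≡ true
≡⇒≡ᵇ≡true {m} refl = ≡ᵇ-refl m

bit : Bool → ℕ
bit true  = 1
bit false = 0

any< : ℕ → (ℕ → Bool) → Bool
any< zero    f = false
any< (suc N) f = f 0 ∨ any< N (f ∘ suc)

count< : ℕ → (ℕ → Bool) → ℕ
count< zero    f = 0
count< (suc N) f = bit (f 0) + count< N (f ∘ suc)

isAt : ∀ {k} → List (Fin k) → ℕ → Fin k → Bool
isAt []      _       a = false
isAt (b ∷ w) zero    a = ⌊ b ≟ a ⌋
isAt (b ∷ w) (suc i) a = isAt w i a

extendℕ : ∀ {n} → ℕ → (Fin n → ℕ) → Fin (suc n) → ℕ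
extendℕ i ρ fz     = i
extendℕ i ρ (fs j) = ρ j

ρ₀ : Fin 0 → ℕ
ρ₀ ()

-- Variables are interpreted by arbitrary natural numbers rather than by
-- positions Fin (length w), so one assignment can be evaluated on several
-- words; only the quantifiers are bounded by the length of the word.
evalℕ : ∀ {ℒ k n} → List (Fin k) → Formula ℒ (Fin k) n → (Fin n → ℕ) → Bool
evalℕ w (letter a x)    ρ = isAt w (ρ x) a
evalℕ w (x <′ y)        ρ = ρ x <ᵇ ρ y
evalℕ w (x =′ y)        ρ = ρ x ≡ᵇ ρ y
evalℕ w ⊤′              ρ = true
evalℕ w (¬′ φ)          ρ = not (evalℕ w φ ρ)
evalℕ w (φ ∧′ ψ)        ρ = evalℕ w φ ρ ∧ evalℕ w ψ ρ
evalℕ w (∃′ φ)          ρ = any< (length w) (λ i → evalℕ w φ (extendℕ i ρ))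
evalℕ w (cong0 _ m _ x) ρ = ⌊ m ∣? ρ x ⌋
evalℕ w (∃^ _ m _ φ)    ρ = ⌊ m ∣? count< (length w) (λ i → evalℕ w φ (extendℕ i ρ)) ⌋

any<-cong : ∀ N {f g} → (∀ i → i < N → f i ≡ g i) → any< N f ≡ any< N g
any<-cong zero    f≗g = refl
any<-cong (suc N) f≗g = cong₂ _∨_ (f≗g 0 z<s) (any<-cong N (λ i i<N → f≗g (suc i) (s<s i<N)))

count<-cong : ∀ N {f g} → (∀ i → i < N → f i ≡ g i) → count< N f ≡ count< N g
count<-cong zero    f≗g = refl
count<-cong (suc N) f≗g =
  cong₂ (λ b c → bit b + c) (f≗g 0 z<s) (count<-cong N (λ i i<N → f≗g (suc i) (s<s i<N)))

extendℕ-cong : ∀ {n} i {ρ ρ′ : Fin n → ℕ} → (∀ j → ρ j ≡ ρ′ j) → ∀ j → extendℕ i ρ j ≡ extendℕ i ρ′ j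
extendℕ-cong i ρ≗ρ′ fz     = refl
extendℕ-cong i ρ≗ρ′ (fs j) = ρ≗ρ′ j

evalℕ-cong : ∀ {ℒ k n} (w : List (Fin k)) (φ : Formula ℒ (Fin k) n) {ρ ρ′} →
             (∀ i → ρ i ≡ ρ′ i) → evalℕ w φ ρ ≡ evalℕ w φ ρ′
evalℕ-cong w (letter a x)    ρ≗ρ′ = cong (λ t → isAt w t a) (ρ≗ρ′ x)
evalℕ-cong w (x <′ y)        ρ≗ρ′ = cong₂ _<ᵇ_ (ρ≗ρ′ x) (ρ≗ρ′ y)
evalℕ-cong w (x =′ y)        ρ≗ρ′ = cong₂ _≡ᵇ_ (ρ≗ρ′ x) (ρ≗ρ′ y)
evalℕ-cong w ⊤′              ρ≗ρ′ = refl
evalℕ-cong w (¬′ φ)          ρ≗ρ′ = cong not (evalℕ-cong w φ ρ≗ρ′)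
evalℕ-cong w (φ ∧′ ψ)        ρ≗ρ′ = cong₂ _∧_ (evalℕ-cong w φ ρ≗ρ′) (evalℕ-cong w ψ ρ≗ρ′)
evalℕ-cong w (∃′ φ)          ρ≗ρ′ =
  any<-cong (length w) (λ i _ → evalℕ-cong w φ (extendℕ-cong i ρ≗ρ′))
evalℕ-cong w (cong0 _ m _ x) ρ≗ρ′ = cong (λ t → ⌊ m ∣? t ⌋) (ρ≗ρ′ x)
evalℕ-cong w (∃^ _ m _ φ)    ρ≗ρ′ =
  cong (λ t → ⌊ m ∣? t ⌋) (count<-cong (length w) (λ i _ → evalℕ-cong w φ (extendℕ-cong i ρ≗ρ′)))

any-tabulate : ∀ {n m} (f : Fin m → Bool) (h : Fin n → Fin m) (g : ℕ → Bool) →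
               (∀ i → f (h i) ≡ g (toℕ i)) → any f (tabulate h) ≡ any< n g
any-tabulate {zero}  f h g fh≗g = refl
any-tabulate {suc n} f h g fh≗g = cong₂ _∨_ (fh≗g fz) (any-tabulate f (h ∘ fs) (g ∘ suc) (fh≗g ∘ fs))

countTrue-tabulate : ∀ {k n m} (f : Fin m → Bool) (h : Fin n → Fin m) (g : ℕ → Bool) →
                     (∀ i → f (h i) ≡ g (toℕ i)) → countTrue (_≟_ {k}) (map f (tabulate h)) ≡ count< n g
countTrue-tabulate {n = zero}  f h g fh≗g = refl
countTrue-tabulate {k} {suc n} f h g fh≗g rewrite fh≗g fz with g 0
... | true  = cong suc (countTrue-tabulate {k} f (h ∘ fs) (g ∘ suc) (fh≗g ∘ fs))
... | false = countTrue-tabulate {k} f (h ∘ fs) (g ∘ suc) (fh≗g ∘ fs)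

isAt-lookup : ∀ {k} (w : List (Fin k)) (i : Fin (length w)) a → isAt w (toℕ i) a ≡ ⌊ lookup w i ≟ a ⌋
isAt-lookup (b ∷ w) fz     a = refl
isAt-lookup (b ∷ w) (fs i) a = isAt-lookup w i a

≟-toℕ : ∀ {n} (i j : Fin n) → ⌊ i ≟ j ⌋ ≡ (toℕ i ≡ᵇ toℕ j)
≟-toℕ i j = truth-ext (λ e → ≡⇒≡ᵇ≡true (cong toℕ (toWitnessᵇ (i ≟ j) e)))
                      (λ e → fromWitnessᵇ (i ≟ j) (toℕ-injective (≡ᵇ≡true⇒≡ e)))

eval≡evalℕ : ∀ {ℒ k n} (w : List (Fin k)) (φ : Formula ℒ (Fin k) n) (v : Fin n → Fin (length w)) →
             eval _≟_ w φ v ≡ evalℕ w φ (toℕ ∘ v)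
eval≡evalℕ-extend : ∀ {ℒ k n} (w : List (Fin k)) (φ : Formula ℒ (Fin k) (suc n)) (v : Fin n → Fin (length w)) i →
                    eval _≟_ w φ (extend (_≟_ {k}) i v) ≡ evalℕ w φ (extendℕ (toℕ i) (toℕ ∘ v))

eval≡evalℕ w (letter a x)    v = sym (isAt-lookup w (v x) a)
eval≡evalℕ w (x <′ y)        v = refl
eval≡evalℕ w (x =′ y)        v = ≟-toℕ (v x) (v y)
eval≡evalℕ w ⊤′              v = refl
eval≡evalℕ w (¬′ φ)          v = cong not (eval≡evalℕ w φ v)
eval≡evalℕ w (φ ∧′ ψ)        v = cong₂ _∧_ (eval≡evalℕ w φ v) (eval≡evalℕ w ψ v)
eval≡evalℕ w (∃′ φ)          v = any-tabulate _ id _ (eval≡evalℕ-extend w φ v)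
eval≡evalℕ w (cong0 _ m _ x) v = refl
eval≡evalℕ {k = k} w (∃^ _ m _ φ) v =
  cong (λ t → ⌊ m ∣? t ⌋) (countTrue-tabulate {k} _ id _ (eval≡evalℕ-extend w φ v))

eval≡evalℕ-extend {k = k} w φ v i = trans (eval≡evalℕ w φ (extend (_≟_ {k}) i v)) (evalℕ-cong w φ toℕ-extend)
  where
  toℕ-extend : ∀ j → toℕ (extend (_≟_ {k}) i v j) ≡ extendℕ (toℕ i) (toℕ ∘ v) j
  toℕ-extend fz     = refl
  toℕ-extend (fs j) = refl

⊨≡evalℕ : ∀ {ℒ k} (w : List (Fin k)) (φ : Sentence ℒ (Fin k)) → _⊨_ _≟_ w φ ≡ evalℕ w φ ρ₀
⊨≡evalℕ w φ = trans (eval≡evalℕ w φ (λ ())) (evalℕ-cong w φ (λ ()))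

any<-elim : ∀ N {f} → any< N f ≡ true → ∃[ i ] (i < N × f i ≡ true)
any<-elim (suc N) {f} e with ∨-elim {f 0} e
... | inj₁ f0 = 0 , z<s , f0
... | inj₂ rest with any<-elim N rest
... | i , i<N , fi = suc i , s<s i<N , fi

any<-intro : ∀ N {f} i → i < N → f i ≡ true → any< N f ≡ true
any<-intro (suc N)     zero    _         fi = ∨-introˡ fi
any<-intro (suc N) {f} (suc i) (s<s i<N) fi = ∨-introʳ {f 0} (any<-intro N i i<N fi)

any<-false : ∀ N {f} → (∀ i → i < N → f i ≡ false) → any< N f ≡ false
any<-false zero    f≡false = refl
any<-false (suc N) f≡false rewrite f≡false 0 z<s = any<-false N (λ i i<N → f≡false (suc i) (s<s i<N))

count<-false : ∀ N {f} → (∀ i → i < N → f i ≡ false) → count< N f ≡ 0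
count<-false zero    f≡false = refl
count<-false (suc N) f≡false rewrite f≡false 0 z<s = count<-false N (λ i i<N → f≡false (suc i) (s<s i<N))

any<-+ : ∀ a b f → any< (a + b) f ≡ any< a f ∨ any< b (f ∘ (a +_))
any<-+ zero    b f = refl
any<-+ (suc a) b f = trans (cong (f 0 ∨_) (any<-+ a b (f ∘ suc))) (sym (∨-assoc (f 0) _ _))

count<-+ : ∀ a b f → count< (a + b) f ≡ count< a f + count< b (f ∘ (a +_))
count<-+ zero    b f = refl
count<-+ (suc a) b f = trans (cong (bit (f 0) +_) (count<-+ a b (f ∘ suc))) (sym (+-assoc (bit (f 0)) _ _))

any<-suc : ∀ N f → any< (suc N) f ≡ any< N f ∨ f N
any<-suc N f = begin
  any< (suc N) f                   ≡⟨ cong (λ t → any< t f) (+-comm 1 N) ⟩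
  any< (N + 1) f                   ≡⟨ any<-+ N 1 f ⟩
  any< N f ∨ (f (N + 0) ∨ false)   ≡⟨ cong (λ t → any< N f ∨ (f t ∨ false)) (+-identityʳ N) ⟩
  any< N f ∨ (f N ∨ false)         ≡⟨ cong (any< N f ∨_) (∨-identityʳ (f N)) ⟩
  any< N f ∨ f N                   ∎

count<-suc : ∀ N f → count< (suc N) f ≡ count< N f + bit (f N)
count<-suc N f = begin
  count< (suc N) f                   ≡⟨ cong (λ t → count< t f) (+-comm 1 N) ⟩
  count< (N + 1) f                   ≡⟨ count<-+ N 1 f ⟩
  count< N f + (bit (f (N + 0)) + 0) ≡⟨ cong (λ t → count< N f + (bit (f t) + 0)) (+-identityʳ N) ⟩
  count< N f + (bit (f N) + 0)       ≡⟨ cong (count< N f +_) (+-identityʳ (bit (f N))) ⟩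
  count< N f + bit (f N)             ∎

module _ (a b N : ℕ) (f : ℕ → Bool) (a+b≤N : a + b ≤ N)
         (before : ∀ z → z < a → f z ≡ false) (after : ∀ z → a + b ≤ z → f z ≡ false) where

  private
    e : ℕ
    e = proj₁ (m≤n⇒∃[o]m+o≡n a+b≤N)

    N≡a+[b+e] : N ≡ a + (b + e)
    N≡a+[b+e] = trans (sym (proj₂ (m≤n⇒∃[o]m+o≡n a+b≤N))) (+-assoc a b e)

    after′ : ∀ i → i < e → f (a + (b + i)) ≡ false
    after′ i _ = after (a + (b + i)) (subst (a + b ≤_) (+-assoc a b i) (m≤m+n (a + b) i))

  any<-window : any< N f ≡ any< b (f ∘ (a +_))
  any<-window = begin
    any< N f                                              ≡⟨ cong (λ t → any< t f) N≡a+[b+e] ⟩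
    any< (a + (b + e)) f                                  ≡⟨ any<-+ a (b + e) f ⟩
    any< a f ∨ any< (b + e) (f ∘ (a +_))                  ≡⟨ cong₂ _∨_ (any<-false a before) (any<-+ b e _) ⟩
    any< b (f ∘ (a +_)) ∨ any< e (f ∘ (a +_) ∘ (b +_))    ≡⟨ cong (any< b _ ∨_) (any<-false e after′) ⟩
    any< b (f ∘ (a +_)) ∨ false                           ≡⟨ ∨-identityʳ _ ⟩
    any< b (f ∘ (a +_))                                   ∎

  count<-window : count< N f ≡ count< b (f ∘ (a +_))
  count<-window = begin
    count< N f                                             ≡⟨ cong (λ t → count< t f) N≡a+[b+e] ⟩
    count< (a + (b + e)) f                                 ≡⟨ count<-+ a (b + e) f ⟩
    count< a f + count< (b + e) (f ∘ (a +_))               ≡⟨ cong₂ _+_ (count<-false a before) (count<-+ b e _) ⟩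
    count< b (f ∘ (a +_)) + count< e (f ∘ (a +_) ∘ (b +_)) ≡⟨ cong (count< b _ +_) (count<-false e after′) ⟩
    count< b (f ∘ (a +_)) + 0                              ≡⟨ +-identityʳ _ ⟩
    count< b (f ∘ (a +_))                                  ∎

count<-mono : ∀ {a b} f → a ≤ b → count< a f ≤ count< b f
count<-mono {a} f a≤b with m≤n⇒∃[o]m+o≡n a≤b
... | e , refl = subst (count< a f ≤_) (sym (count<-+ a e f)) (m≤m+n _ _)

suc≤count<⇔ : ∀ z f j → suc j ≤ count< z f ⇔ (∃[ y ] (y < z × f y ≡ true × j ≤ count< y f))
suc≤count<⇔ z f j = mk⇔ (witness z) enough
  where
  witness : ∀ z → suc j ≤ count< z f → ∃[ y ] (y < z × f y ≡ true × j ≤ count< y f)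
  witness (suc z) j<count rewrite count<-suc z f with f z in fz≡
  ... | false = let (y , y<z , fy , j≤) = witness z (subst (suc j ≤_) (+-identityʳ _) j<count)
                in y , ≤-trans y<z (n≤1+n _) , fy , j≤
  ... | true with j ≤? count< z f
  ...   | yes j≤ = z , n<1+n z , fz≡ , j≤
  ...   | no  j≰ = ⊥-elim (j≰ (≤-pred (subst (suc j ≤_) (+-comm _ 1) j<count)))
  enough : ∃[ y ] (y < z × f y ≡ true × j ≤ count< y f) → suc j ≤ count< z f
  enough (y , y<z , fy , j≤) = ≤-trans (subst (suc j ≤_) (sym count-suc-y) (s≤s j≤)) (count<-mono f y<z)
    where
    count-suc-y : count< (suc y) f ≡ suc (count< y f)
    count-suc-y = trans (count<-suc y f) (trans (cong (λ b → count< y f + bit b) fy) (+-comm _ 1))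

count<-beyond : ∀ N f j → count< N (λ y → f y ∧ ⌊ j ≤? count< y f ⌋) ≡ count< N f ∸ j
count<-beyond zero    f j = sym (0∸n≡0 j)
count<-beyond (suc N) f j
  rewrite count<-suc N (λ y → f y ∧ ⌊ j ≤? count< y f ⌋) | count<-suc N f | count<-beyond N f j with f N
... | false = trans (+-identityʳ _) (cong (_∸ j) (sym (+-identityʳ _)))
... | true with j ≤? count< N f
...   | yes j≤ = sym (+-∸-comm 1 j≤)
...   | no  j≰ = trans (+-identityʳ _) (trans (m≤n⇒m∸n≡0 (<⇒≤ (≰⇒> j≰)))
                                            (sym (m≤n⇒m∸n≡0 (subst (_≤ j) (+-comm 1 _) (≰⇒> j≰)))))

lift : ∀ {n m} → (Fin n → Fin m) → Fin (suc n) → Fin (suc m)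
lift σ fz     = fz
lift σ (fs i) = fs (σ i)

rename : ∀ {ℒ A n m} → Formula ℒ A n → (Fin n → Fin m) → Formula ℒ A m
rename (letter a x)    σ = letter a (σ x)
rename (x <′ y)        σ = σ x <′ σ y
rename (x =′ y)        σ = σ x =′ σ y
rename ⊤′              σ = ⊤′
rename (¬′ φ)          σ = ¬′ (rename φ σ)
rename (φ ∧′ ψ)        σ = rename φ σ ∧′ rename ψ σ
rename (∃′ φ)          σ = ∃′ (rename φ (lift σ))
rename (cong0 hc m p x) σ = cong0 hc m p (σ x)
rename (∃^ hm m p φ)    σ = ∃^ hm m p (rename φ (lift σ))

extendℕ-lift : ∀ {n m} i (ρ : Fin m → ℕ) (σ : Fin n → Fin m) j → extendℕ i ρ (lift σ j) ≡ extendℕ i (ρ ∘ σ) j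
extendℕ-lift i ρ σ fz     = refl
extendℕ-lift i ρ σ (fs j) = refl

rename-sem : ∀ {ℒ k n m} (w : List (Fin k)) (φ : Formula ℒ (Fin k) n) (σ : Fin n → Fin m) ρ →
             evalℕ w (rename φ σ) ρ ≡ evalℕ w φ (ρ ∘ σ)
rename-sem w (letter a x)    σ ρ = refl
rename-sem w (x <′ y)        σ ρ = refl
rename-sem w (x =′ y)        σ ρ = refl
rename-sem w ⊤′              σ ρ = refl
rename-sem w (¬′ φ)          σ ρ = cong not (rename-sem w φ σ ρ)
rename-sem w (φ ∧′ ψ)        σ ρ = cong₂ _∧_ (rename-sem w φ σ ρ) (rename-sem w ψ σ ρ)
rename-sem w (∃′ φ)          σ ρ = any<-cong (length w) λ i _ →
  trans (rename-sem w φ (lift σ) (extendℕ i ρ)) (evalℕ-cong w φ (extendℕ-lift i ρ σ))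
rename-sem w (cong0 _ m _ x) σ ρ = refl
rename-sem w (∃^ _ m _ φ)    σ ρ = cong (λ t → ⌊ m ∣? t ⌋) (count<-cong (length w) λ i _ →
  trans (rename-sem w φ (lift σ) (extendℕ i ρ)) (evalℕ-cong w φ (extendℕ-lift i ρ σ)))

module _ {ℒ : Logic} {k : ℕ} where

  Fm : ℕ → Set
  Fm n = Formula ℒ (Fin k) n

  ⊥′ : ∀ {n} → Fm n
  ⊥′ = ¬′ ⊤′

  _∨′_ : ∀ {n} → Fm n → Fm n → Fm n
  φ ∨′ ψ = ¬′ ((¬′ φ) ∧′ (¬′ ψ))

  lit′ : ∀ {n} → Bool → Fm n
  lit′ true  = ⊤′
  lit′ false = ⊥′

  if′ : ∀ {n} → Fm n → Fm n → Fm n → Fm n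
  if′ c p q = (c ∧′ p) ∨′ ((¬′ c) ∧′ q)

  ⋁′ : ∀ {n} → (ℕ → Fm n) → ℕ → Fm n
  ⋁′ f zero    = ⊥′
  ⋁′ f (suc j) = f 0 ∨′ ⋁′ (f ∘ suc) j

  ⋁Fin′ : ∀ {n} s → (Fin s → Fm n) → Fm n
  ⋁Fin′ zero    f = ⊥′
  ⋁Fin′ (suc s) f = f fz ∨′ ⋁Fin′ s (f ∘ fs)

  Succ′ : ∀ {n} → Fin n → Fin n → Fm n
  Succ′ z y = (z <′ y) ∧′ (¬′ (∃′ ((fs z <′ fz) ∧′ (fz <′ fs y))))

  Distance′ : ∀ {n} → ℕ → Fin n → Fin n → Fm n
  Distance′ zero    z p = z =′ p
  Distance′ (suc t) z p = ∃′ ((Succ′ (fs z) fz) ∧′ (Distance′ t fz (fs p)))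

  module _ (w : List (Fin k)) where

    ∨′-sem : ∀ {n} (φ ψ : Fm n) ρ → evalℕ w (φ ∨′ ψ) ρ ≡ evalℕ w φ ρ ∨ evalℕ w ψ ρ
    ∨′-sem φ ψ ρ with evalℕ w φ ρ | evalℕ w ψ ρ
    ... | true  | _     = refl
    ... | false | true  = refl
    ... | false | false = refl

    lit′-sem : ∀ {n} b (ρ : Fin n → ℕ) → evalℕ w (lit′ b) ρ ≡ b
    lit′-sem true  ρ = refl
    lit′-sem false ρ = refl

    if′-sem : ∀ {n} (c p q : Fm n) ρ →
              evalℕ w (if′ c p q) ρ ≡ (if evalℕ w c ρ then evalℕ w p ρ else evalℕ w q ρ)
    if′-sem c p q ρ rewrite ∨′-sem (c ∧′ p) ((¬′ c) ∧′ q) ρ with evalℕ w c ρ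
    ... | true  = ∨-identityʳ _
    ... | false = refl

    ⋁′-sem : ∀ {n} (f : ℕ → Fm n) j ρ → evalℕ w (⋁′ f j) ρ ≡ any< j (λ r → evalℕ w (f r) ρ)
    ⋁′-sem f zero    ρ = refl
    ⋁′-sem f (suc j) ρ =
      trans (∨′-sem (f 0) (⋁′ (f ∘ suc) j) ρ) (cong (evalℕ w (f 0) ρ ∨_) (⋁′-sem (f ∘ suc) j ρ))

    ⋁Fin′-sem : ∀ {n} s (f : Fin s → Fm n) ρ → evalℕ w (⋁Fin′ s f) ρ ≡ true ⇔ (∃[ a ] (evalℕ w (f a) ρ ≡ true))
    ⋁Fin′-sem zero    f ρ = mk⇔ (λ ()) λ { (() , _) }
    ⋁Fin′-sem (suc s) f ρ = mk⇔ fw bw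
      where
      fw : evalℕ w (⋁Fin′ (suc s) f) ρ ≡ true → ∃[ a ] (evalℕ w (f a) ρ ≡ true)
      fw e with ∨-elim (trans (sym (∨′-sem (f fz) (⋁Fin′ s (f ∘ fs)) ρ)) e)
      ... | inj₁ f0 = fz , f0
      ... | inj₂ rest with to (⋁Fin′-sem s (f ∘ fs) ρ) rest
      ... | a , fa = fs a , fa
      bw : ∃[ a ] (evalℕ w (f a) ρ ≡ true) → evalℕ w (⋁Fin′ (suc s) f) ρ ≡ true
      bw (fz , f0)   = trans (∨′-sem (f fz) (⋁Fin′ s (f ∘ fs)) ρ) (∨-introˡ f0)
      bw (fs a , fa) = trans (∨′-sem (f fz) (⋁Fin′ s (f ∘ fs)) ρ)
                             (∨-introʳ {evalℕ w (f fz) ρ} (from (⋁Fin′-sem s (f ∘ fs) ρ) (a , fa)))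

    Succ′-sem : ∀ {n} (z y : Fin n) ρ → ρ y < length w → evalℕ w (Succ′ z y) ρ ≡ true ⇔ ρ y ≡ suc (ρ z)
    Succ′-sem z y ρ y<len = mk⇔ fw bw
      where
      fw : evalℕ w (Succ′ z y) ρ ≡ true → ρ y ≡ suc (ρ z)
      fw e with m≤n⇒m<n∨m≡n (<ᵇ≡true⇒< (∧-elimˡ e))
      ... | inj₂ sz≡y   = sym sz≡y
      ... | inj₁ sz<y = ⊥-elim (not-elim (∧-elimʳ {ρ z <ᵇ ρ y} e)
              (any<-intro (length w) (suc (ρ z)) (<-trans sz<y y<len)
                 (∧-intro (<⇒<ᵇ≡true (n<1+n (ρ z))) (<⇒<ᵇ≡true sz<y))))
      bw : ρ y ≡ suc (ρ z) → evalℕ w (Succ′ z y) ρ ≡ true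
      bw y≡sz = ∧-intro (<⇒<ᵇ≡true (subst (ρ z <_) (sym y≡sz) (n<1+n (ρ z)))) (not-intro nothing-between)
        where
        nothing-between : any< (length w) (λ u → (ρ z <ᵇ u) ∧ (u <ᵇ ρ y)) ≡ true → ⊥
        nothing-between e with any<-elim (length w) e
        ... | u , _ , between = <⇒≱ (<ᵇ≡true⇒< (∧-elimˡ between))
                                    (≤-pred (subst (u <_) y≡sz (<ᵇ≡true⇒< (∧-elimʳ {ρ z <ᵇ u} between))))

    Distance′-sem : ∀ {n} t (z p : Fin n) ρ → ρ p < length w →
                    evalℕ w (Distance′ t z p) ρ ≡ true ⇔ ρ z + t ≡ ρ p
    Distance′-sem zero z p ρ p<len =
      mk⇔ (λ e → trans (+-identityʳ _) (≡ᵇ≡true⇒≡ e)) (λ e → ≡⇒≡ᵇ≡true (trans (sym (+-identityʳ _)) e))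
    Distance′-sem (suc t) z p ρ p<len = mk⇔ fw bw
      where
      fw : evalℕ w (Distance′ (suc t) z p) ρ ≡ true → ρ z + suc t ≡ ρ p
      fw e with any<-elim (length w) e
      ... | u , u<len , step = begin
        ρ z + suc t   ≡⟨ +-suc (ρ z) t ⟩
        suc (ρ z) + t ≡⟨ cong (_+ t) (sym (to (Succ′-sem (fs z) fz (extendℕ u ρ) u<len) (∧-elimˡ step))) ⟩
        u + t         ≡⟨ to (Distance′-sem t fz (fs p) (extendℕ u ρ) p<len) (∧-elimʳ step) ⟩
        ρ p           ∎
      bw : ρ z + suc t ≡ ρ p → evalℕ w (Distance′ (suc t) z p) ρ ≡ true
      bw e = any<-intro (length w) (suc (ρ z)) sz<len
               (∧-intro (from (Succ′-sem (fs z) fz (extendℕ (suc (ρ z)) ρ) sz<len) refl)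
                        (from (Distance′-sem t fz (fs p) (extendℕ (suc (ρ z)) ρ) p<len) (trans (sym (+-suc (ρ z) t)) e)))
        where
        sz<len : suc (ρ z) < length w
        sz<len = ≤-<-trans (subst (suc (ρ z) ≤_) (trans (sym (+-suc (ρ z) t)) e) (s≤s (m≤m+n (ρ z) t))) p<len

∣-∸-shift : ∀ {m a b c} → a ≤ b → m ∣ a + c → m ∣ b + c ⇔ m ∣ b ∸ a
∣-∸-shift {m} {a} {b} {c} a≤b m∣a+c =
  mk⇔ (λ m∣b+c → ∣m+n∣m⇒∣n (subst (m ∣_) b+c≡ m∣b+c) m∣a+c)
      (λ m∣b∸a → subst (m ∣_) (sym b+c≡) (∣m∣n⇒∣m+n m∣a+c m∣b∸a))
  where
  b+c≡ : b + c ≡ (a + c) + (b ∸ a)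
  b+c≡ = begin
    b + c             ≡⟨ cong (_+ c) (sym (m∸n+n≡m a≤b)) ⟩
    (b ∸ a) + a + c   ≡⟨ +-assoc (b ∸ a) a c ⟩
    (b ∸ a) + (a + c) ≡⟨ +-comm (b ∸ a) (a + c) ⟩
    (a + c) + (b ∸ a) ∎

complement-mod : ∀ m′ n → ∃[ c ] (c < suc m′ × suc m′ ∣ n + c)
complement-mod m′ zero = 0 , z<s , (suc m′ ∣0)
complement-mod m′ (suc n) with complement-mod m′ n
... | zero , _ , m∣n+0 =
  m′ , n<1+n m′ , subst (suc m′ ∣_) (+-suc n m′) (∣m∣n⇒∣m+n (subst (suc m′ ∣_) (+-identityʳ n) m∣n+0) ∣-refl)
... | suc c , s≤s c<m′ , m∣n+sc = c , ≤-trans (n≤1+n _) (s≤s c<m′) , subst (suc m′ ∣_) (+-suc n c) m∣n+sc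

module _ {ℒ : Logic} {k : ℕ} (hc : HasCong ℒ) where

  -- m ∣ v + c holds iff v = z + t with m ∣ z, t < m and m ∣ t + c:
  -- the residue t is guessed by a disjunction, z is found by cong0.
  congruentCase : ∀ {n} m → 1 ≤ m → ℕ → Fin n → ℕ → Fm {ℒ} {k} n
  congruentCase m q c v t = (lit′ ⌊ m ∣? t + c ⌋) ∧′ (∃′ ((cong0 hc m q fz) ∧′ (Distance′ t fz (fs v))))

  Congruent′ : ∀ {n} m → 1 ≤ m → ℕ → Fin n → Fm {ℒ} {k} n
  Congruent′ m q c v = ⋁′ (congruentCase m q c v) m

  gapCase : ∀ {n} m → 1 ≤ m → Fin n → Fin n → ℕ → Fm {ℒ} {k} n
  gapCase m q I v c = (Congruent′ m q (suc c) I) ∧′ (Congruent′ m q c v)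

  -- m ∣ v − (I + 1) iff m ∣ v + c for the c < m with m ∣ (I + 1) + c.
  GapCongruent′ : ∀ {n} m → 1 ≤ m → Fin n → Fin n → Fm {ℒ} {k} n
  GapCongruent′ m q I v = ⋁′ (gapCase m q I v) m

  module _ (w : List (Fin k)) where

    Congruent′-sem : ∀ {n} m (q : 1 ≤ m) c (v : Fin n) ρ → ρ v < length w →
                     evalℕ w (Congruent′ m q c v) ρ ≡ true ⇔ m ∣ ρ v + c
    Congruent′-sem m@(suc m′) q c v ρ v<len = mk⇔ fw bw
      where
      case : ℕ → Bool
      case t = evalℕ w (congruentCase m q c v t) ρ
      split : ∀ z t → z + t ≡ ρ v → z + (t + c) ≡ ρ v + c
      split z t z+t≡v = trans (sym (+-assoc z t c)) (cong (_+ c) z+t≡v)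
      fw : evalℕ w (Congruent′ m q c v) ρ ≡ true → m ∣ ρ v + c
      fw e with any<-elim m {case} (trans (sym (⋁′-sem w (congruentCase m q c v) m ρ)) e)
      ... | t , _ , case-t with any<-elim (length w) (∧-elimʳ {evalℕ w (lit′ ⌊ m ∣? t + c ⌋) ρ} case-t)
      ... | z , _ , at-z = subst (m ∣_) (split z t z+t≡v) (∣m∣n⇒∣m+n m∣z m∣t+c)
        where
        m∣z = toWitnessᵇ (m ∣? z) (∧-elimˡ at-z)
        m∣t+c = toWitnessᵇ (m ∣? t + c) (trans (sym (lit′-sem w _ ρ)) (∧-elimˡ case-t))
        z+t≡v = to (Distance′-sem w t fz (fs v) (extendℕ z ρ) v<len) (∧-elimʳ {⌊ m ∣? z ⌋} at-z)
      bw : m ∣ ρ v + c → evalℕ w (Congruent′ m q c v) ρ ≡ true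
      bw m∣v+c = trans (⋁′-sem w (congruentCase m q c v) m ρ) (any<-intro m {case} t (m%n<n (ρ v) m)
                   (∧-intro (trans (lit′-sem w _ ρ) (fromWitnessᵇ (m ∣? t + c) m∣t+c))
                     (any<-intro (length w) z (≤-<-trans (m/n*n≤m (ρ v) m) v<len)
                       (∧-intro (fromWitnessᵇ (m ∣? z) (n∣m*n (ρ v / m)))
                                (from (Distance′-sem w t fz (fs v) (extendℕ z ρ) v<len) z+t≡v)))))
        where
        t = ρ v % m
        z = (ρ v / m) * m
        z+t≡v : z + t ≡ ρ v
        z+t≡v = trans (+-comm z t) (sym (m≡m%n+[m/n]*n (ρ v) m))
        m∣t+c : m ∣ t + c
        m∣t+c = ∣m+n∣m⇒∣n (subst (m ∣_) (sym (split z t z+t≡v)) m∣v+c) (n∣m*n (ρ v / m))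

    GapCongruent′-sem : ∀ {n} m (q : 1 ≤ m) (I v : Fin n) ρ → ρ I < ρ v → ρ v < length w →
                        evalℕ w (GapCongruent′ m q I v) ρ ≡ true ⇔ m ∣ ρ v ∸ suc (ρ I)
    GapCongruent′-sem m@(suc m′) q I v ρ I<v v<len = mk⇔ fw bw
      where
      I<len = <-trans I<v v<len
      case : ℕ → Bool
      case c = evalℕ w (gapCase m q I v c) ρ
      fw : evalℕ w (GapCongruent′ m q I v) ρ ≡ true → m ∣ ρ v ∸ suc (ρ I)
      fw e with any<-elim m {case} (trans (sym (⋁′-sem w (gapCase m q I v) m ρ)) e)
      ... | c , _ , case-c = to (∣-∸-shift I<v m∣sI+c) m∣v+c
        where
        m∣sI+c = subst (m ∣_) (+-suc (ρ I) c) (to (Congruent′-sem m q (suc c) I ρ I<len) (∧-elimˡ case-c))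
        m∣v+c = to (Congruent′-sem m q c v ρ v<len) (∧-elimʳ {evalℕ w (Congruent′ m q (suc c) I) ρ} case-c)
      bw : m ∣ ρ v ∸ suc (ρ I) → evalℕ w (GapCongruent′ m q I v) ρ ≡ true
      bw m∣gap with complement-mod m′ (suc (ρ I))
      ... | c , c<m , m∣sI+c = trans (⋁′-sem w (gapCase m q I v) m ρ) (any<-intro m {case} c c<m
              (∧-intro (from (Congruent′-sem m q (suc c) I ρ I<len) (subst (m ∣_) (sym (+-suc (ρ I) c)) m∣sI+c))
                       (from (Congruent′-sem m q c v ρ v<len) (from (∣-∸-shift I<v m∣sI+c) m∣gap))))

module _ {ℒ : Logic} {k : ℕ} where

  AtLeastBefore′ : ∀ {n} → ℕ → Fm {ℒ} {k} (suc n) → Fm {ℒ} {k} (suc n)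
  AtLeastBefore′ zero    χ = ⊤′
  AtLeastBefore′ (suc j) χ = ∃′ ((fz <′ fs fz) ∧′ ((rename χ (lift fs)) ∧′ (rename (AtLeastBefore′ j χ) (lift fs))))

  AtLeast′ : ∀ {n} → ℕ → Fm {ℒ} {k} (suc n) → Fm {ℒ} {k} n
  AtLeast′ zero    χ = ⊤′
  AtLeast′ (suc j) χ = ∃′ (χ ∧′ AtLeastBefore′ j χ)

  Exactly′ : ∀ {n} → ℕ → Fm {ℒ} {k} (suc n) → Fm {ℒ} {k} n
  Exactly′ j χ = (AtLeast′ j χ) ∧′ (¬′ (AtLeast′ (suc j) χ))

  ∀′ : ∀ {n} → Fm {ℒ} {k} (suc n) → Fm {ℒ} {k} n
  ∀′ χ = ¬′ (∃′ (¬′ χ))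

  _⇒′_ : ∀ {n} → Fm {ℒ} {k} n → Fm {ℒ} {k} n → Fm {ℒ} {k} n
  χ ⇒′ ψ = ¬′ (χ ∧′ (¬′ ψ))

  module _ (w : List (Fin k)) where

    holdsAt : ∀ {n} → Fm {ℒ} {k} (suc n) → (Fin n → ℕ) → ℕ → Bool
    holdsAt χ ρ y = evalℕ w χ (extendℕ y ρ)

    count : ∀ {n} → Fm {ℒ} {k} (suc n) → (Fin n → ℕ) → ℕ
    count χ ρ = count< (length w) (holdsAt χ ρ)

    ∀′-sem : ∀ {n} (χ : Fm (suc n)) ρ → evalℕ w (∀′ χ) ρ ≡ true ⇔ (∀ z → z < length w → holdsAt χ ρ z ≡ true)
    ∀′-sem χ ρ = mk⇔ fw bw
      where
      fw : evalℕ w (∀′ χ) ρ ≡ true → ∀ z → z < length w → holdsAt χ ρ z ≡ true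
      fw e z z<w with holdsAt χ ρ z in χz
      ... | true  = refl
      ... | false = ⊥-elim (not-elim e (any<-intro (length w) z z<w (cong not χz)))
      bw : (∀ z → z < length w → holdsAt χ ρ z ≡ true) → evalℕ w (∀′ χ) ρ ≡ true
      bw all = not-intro λ e → let (z , z<w , ¬χz) = any<-elim (length w) e in not-elim ¬χz (all z z<w)

    ⇒′-sem : ∀ {n} (χ ψ : Fm n) ρ → evalℕ w (χ ⇒′ ψ) ρ ≡ true ⇔ (evalℕ w χ ρ ≡ true → evalℕ w ψ ρ ≡ true)
    ⇒′-sem χ ψ ρ with evalℕ w χ ρ | evalℕ w ψ ρ
    ... | true  | true  = mk⇔ (λ _ _ → refl) (λ _ → refl)
    ... | true  | false = mk⇔ (λ ()) (λ f → f refl)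
    ... | false | _     = mk⇔ (λ _ ()) (λ _ → refl)

    rename-lift-fs-sem : ∀ {n} (χ : Fm (suc n)) y (ρ : Fin (suc n) → ℕ) →
                         evalℕ w (rename χ (lift fs)) (extendℕ y ρ) ≡ holdsAt χ (ρ ∘ fs) y
    rename-lift-fs-sem χ y ρ = trans (rename-sem w χ (lift fs) (extendℕ y ρ)) (evalℕ-cong w χ (extendℕ-lift y ρ fs))

    AtLeastBefore′-sem : ∀ {n} j (χ : Fm (suc n)) ρ → ρ fz ≤ length w →
                         evalℕ w (AtLeastBefore′ j χ) ρ ≡ true ⇔ j ≤ count< (ρ fz) (holdsAt χ (ρ ∘ fs))
    AtLeastBefore′-sem zero    χ ρ _ = mk⇔ (λ _ → z≤n) (λ _ → refl)
    AtLeastBefore′-sem (suc j) χ ρ x≤len = mk⇔ fw bw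
      where
      f = holdsAt χ (ρ ∘ fs)
      earlier : ∀ {y} → y < ρ fz → evalℕ w (AtLeastBefore′ j χ) (extendℕ y (ρ ∘ fs)) ≡ true ⇔ j ≤ count< y f
      earlier {y} y<x = AtLeastBefore′-sem j χ (extendℕ y (ρ ∘ fs)) (<⇒≤ (<-≤-trans y<x x≤len))
      fw : evalℕ w (AtLeastBefore′ (suc j) χ) ρ ≡ true → suc j ≤ count< (ρ fz) f
      fw e with any<-elim (length w) e
      ... | y , _ , at-y = from (suc≤count<⇔ (ρ fz) f j) (y , y<x , fy , to (earlier y<x) before-y)
        where
        y<x = <ᵇ≡true⇒< {y} {ρ fz} (∧-elimˡ at-y)
        rest = ∧-elimʳ {y <ᵇ ρ fz} at-y
        fy = trans (sym (rename-lift-fs-sem χ y ρ)) (∧-elimˡ rest)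
        before-y = trans (sym (rename-lift-fs-sem (AtLeastBefore′ j χ) y ρ))
                         (∧-elimʳ {evalℕ w (rename χ (lift fs)) (extendℕ y ρ)} rest)
      bw : suc j ≤ count< (ρ fz) f → evalℕ w (AtLeastBefore′ (suc j) χ) ρ ≡ true
      bw sj≤ with to (suc≤count<⇔ (ρ fz) f j) sj≤
      ... | y , y<x , fy , j≤ = any<-intro (length w) y (<-≤-trans y<x x≤len)
              (∧-intro (<⇒<ᵇ≡true y<x)
                (∧-intro (trans (rename-lift-fs-sem χ y ρ) fy)
                         (trans (rename-lift-fs-sem (AtLeastBefore′ j χ) y ρ) (from (earlier y<x) j≤))))

    AtLeast′-sem : ∀ {n} j (χ : Fm (suc n)) ρ → evalℕ w (AtLeast′ j χ) ρ ≡ true ⇔ j ≤ count χ ρ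
    AtLeast′-sem zero    χ ρ = mk⇔ (λ _ → z≤n) (λ _ → refl)
    AtLeast′-sem (suc j) χ ρ = mk⇔ fw bw
      where
      f = holdsAt χ ρ
      fw : evalℕ w (AtLeast′ (suc j) χ) ρ ≡ true → suc j ≤ count χ ρ
      fw e with any<-elim (length w) e
      ... | y , y<len , at-y = from (suc≤count<⇔ (length w) f j)
              (y , y<len , ∧-elimˡ at-y , to (AtLeastBefore′-sem j χ (extendℕ y ρ) (<⇒≤ y<len)) (∧-elimʳ {f y} at-y))
      bw : suc j ≤ count χ ρ → evalℕ w (AtLeast′ (suc j) χ) ρ ≡ true
      bw sj≤ with to (suc≤count<⇔ (length w) f j) sj≤
      ... | y , y<len , fy , j≤ = any<-intro (length w) y y<len
              (∧-intro fy (from (AtLeastBefore′-sem j χ (extendℕ y ρ) (<⇒≤ y<len)) j≤))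

    Exactly′-sem : ∀ {n} j (χ : Fm (suc n)) ρ → evalℕ w (Exactly′ j χ) ρ ≡ true ⇔ count χ ρ ≡ j
    Exactly′-sem j χ ρ = mk⇔ fw bw
      where
      fw : evalℕ w (Exactly′ j χ) ρ ≡ true → count χ ρ ≡ j
      fw e = ≤-antisym (≤-pred (≰⇒> (not-elim (∧-elimʳ {evalℕ w (AtLeast′ j χ) ρ} e)
                                     ∘ from (AtLeast′-sem (suc j) χ ρ))))
                       (to (AtLeast′-sem j χ ρ) (∧-elimˡ e))
      bw : count χ ρ ≡ j → evalℕ w (Exactly′ j χ) ρ ≡ true
      bw refl = ∧-intro (from (AtLeast′-sem _ χ ρ) ≤-refl)
                        (not-intro (λ e → <-irrefl refl (to (AtLeast′-sem (suc (count χ ρ)) χ ρ) e)))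

    count-beyond : ∀ {n} j (χ : Fm (suc n)) ρ → count (χ ∧′ AtLeastBefore′ j χ) ρ ≡ count χ ρ ∸ j
    count-beyond j χ ρ = trans (count<-cong (length w) beyond) (count<-beyond (length w) (holdsAt χ ρ) j)
      where
      beyond : ∀ y → y < length w →
               holdsAt (χ ∧′ AtLeastBefore′ j χ) ρ y ≡ holdsAt χ ρ y ∧ ⌊ j ≤? count< y (holdsAt χ ρ) ⌋
      beyond y y<len = cong (holdsAt χ ρ y ∧_) (≡⌊⌋ (j ≤? _) (AtLeastBefore′-sem j χ (extendℕ y ρ) (<⇒≤ y<len)))

-- If at least (m−1)e positions satisfy χ, then count + e ≡ count − (m−1)e (mod m),
-- and the positions after the first (m−1)e are counted by ∃^; otherwise the
-- count is one of the finitely many values below (m−1)e.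
module _ {ℒ : Logic} {k : ℕ} (hm : HasModQ ℒ) where

  exactCase : ∀ {n} → ℕ → ℕ → Fm {ℒ} {k} (suc n) → ℕ → Fm {ℒ} {k} n
  exactCase m e χ j = (Exactly′ j χ) ∧′ (lit′ ⌊ m ∣? j + e ⌋)

  CountCongruent′ : ∀ {n} m → 1 ≤ m → ℕ → Fm {ℒ} {k} (suc n) → Fm {ℒ} {k} n
  CountCongruent′ m q e χ =
    if′ (AtLeast′ (m * e ∸ e) χ)
        (∃^ hm m q (χ ∧′ AtLeastBefore′ (m * e ∸ e) χ))
        (⋁′ (exactCase m e χ) (m * e ∸ e))

  module _ (w : List (Fin k)) where

    CountCongruent′-sem : ∀ {n} m (q : 1 ≤ m) e (χ : Fm (suc n)) ρ →
                          evalℕ w (CountCongruent′ m q e χ) ρ ≡ ⌊ m ∣? count w χ ρ + e ⌋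
    CountCongruent′-sem m@(suc _) q e χ ρ
      rewrite if′-sem w (AtLeast′ (m * e ∸ e) χ) (∃^ hm m q (χ ∧′ AtLeastBefore′ (m * e ∸ e) χ))
                        (⋁′ (exactCase m e χ) (m * e ∸ e)) ρ
      with evalℕ w (AtLeast′ (m * e ∸ e) χ) ρ in many
    ... | true = begin
      ⌊ m ∣? count w (χ ∧′ AtLeastBefore′ (m * e ∸ e) χ) ρ ⌋
        ≡⟨ cong (λ t → ⌊ m ∣? t ⌋) (count-beyond w (m * e ∸ e) χ ρ) ⟩
      ⌊ m ∣? C ∸ (m * e ∸ e) ⌋
        ≡⟨ ⌊⌋-⇔ (m ∣? C ∸ (m * e ∸ e)) (m ∣? C + e) (⇔-sym shift) ⟩
      ⌊ m ∣? C + e ⌋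
        ∎
      where
      C = count w χ ρ
      shift : m ∣ C + e ⇔ m ∣ C ∸ (m * e ∸ e)
      shift = ∣-∸-shift (to (AtLeast′-sem w _ χ ρ) many) (subst (m ∣_) (sym (m∸n+n≡m (m≤n*m e m))) (m∣m*n e))
    ... | false = trans (⋁′-sem w (exactCase m e χ) (m * e ∸ e) ρ) (≡⌊⌋ (m ∣? C + e) (mk⇔ fw bw))
      where
      C = count w χ ρ
      exact : ℕ → Bool
      exact j = evalℕ w (exactCase m e χ j) ρ
      fw : any< (m * e ∸ e) exact ≡ true → m ∣ C + e
      fw e′ with any<-elim (m * e ∸ e) {exact} e′
      ... | j , _ , exact-j = subst (λ t → m ∣ t + e) (sym (to (Exactly′-sem w j χ ρ) (∧-elimˡ exact-j)))
                                    (toWitnessᵇ (m ∣? j + e) (trans (sym (lit′-sem w _ ρ))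
                                                                    (∧-elimʳ {evalℕ w (Exactly′ j χ) ρ} exact-j)))
      bw : m ∣ C + e → any< (m * e ∸ e) exact ≡ true
      bw m∣C+e = any<-intro (m * e ∸ e) {exact} C (≰⇒> (not-elim (cong not many) ∘ from (AtLeast′-sem w _ χ ρ)))
                   (∧-intro (from (Exactly′-sem w C χ ρ) refl) (trans (lit′-sem w _ ρ) (fromWitnessᵇ (m ∣? C + e) m∣C+e)))

isAt-++ˡ : ∀ {k} (p q : List (Fin k)) i a → i < length p → isAt (p ++ q) i a ≡ isAt p i a
isAt-++ˡ (b ∷ p) q zero    a _         = refl
isAt-++ˡ (b ∷ p) q (suc i) a (s<s i<p) = isAt-++ˡ p q i a i<p

isAt-++ʳ : ∀ {k} (p q : List (Fin k)) i a → isAt (p ++ q) (length p + i) a ≡ isAt q i a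
isAt-++ʳ []      q i a = refl
isAt-++ʳ (b ∷ p) q i a = isAt-++ʳ p q i a

isAt-map-injective : ∀ {s d} (h : Fin s → Fin d) → Injective _≡_ _≡_ h →
                     ∀ w i a → isAt (map h w) i (h a) ≡ isAt w i a
isAt-map-injective h h-inj []      i       a = refl
isAt-map-injective h h-inj (b ∷ w) zero    a = ⌊⌋-⇔ (h b ≟ h a) (b ≟ a) (mk⇔ h-inj (cong h))
isAt-map-injective h h-inj (b ∷ w) (suc i) a = isAt-map-injective h h-inj w i a

isAt-map-∉ : ∀ {s d} (h : Fin s → Fin d) c → (∀ a → h a ≢ c) → ∀ w i → isAt (map h w) i c ≡ false
isAt-map-∉ h c c∉h []      i       = refl
isAt-map-∉ h c c∉h (b ∷ w) zero    with h b ≟ c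
... | yes hb≡c = ⊥-elim (c∉h b hb≡c)
... | no  _    = refl
isAt-map-∉ h c c∉h (b ∷ w) (suc i) = isAt-map-∉ h c c∉h w i

-- Where a variable of a Δ-formula sits in the word x·w·y: on one of the
-- two markers, or on a position of w named by a variable of the Σ-formula.
data Site (n : ℕ) : Set where
  onX onY : Site n
  at      : Fin n → Site n

extendSite : ∀ {n n′} → Site n′ → (Fin n → Site n′) → Fin (suc n) → Site n′
extendSite σ τ fz     = σ
extendSite σ τ (fs i) = τ i

weakenSite : ∀ {n} → Site n → Site (suc n)
weakenSite onX    = onX
weakenSite onY    = onY
weakenSite (at i) = at (fs i)

atNew : ∀ {n n′} → (Fin n → Site n′) → Fin (suc n) → Site (suc n′)
atNew τ = extendSite (at fz) (weakenSite ∘ τ)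

module Unframe {ℒ : Logic} {s d : ℕ} (h : Fin s → Fin d) (h-inj : Injective _≡_ _≡_ h) (x y : Fin d) where

  FS : ℕ → Set
  FS n = Formula ℒ (Fin s) n

  FD : ℕ → Set
  FD n = Formula ℒ (Fin d) n

  letterOf : ∀ {n} → Fin d → Fin n → FS n
  letterOf b i with any? (λ a → h a ≟ b)
  ... | yes (a , _) = letter a i
  ... | no  _       = ⊥′

  unframeLetter : ∀ {n} → Fin d → Site n → FS n
  unframeLetter b onX    = lit′ ⌊ x ≟ b ⌋
  unframeLetter b onY    = lit′ ⌊ y ≟ b ⌋
  unframeLetter b (at i) = letterOf b i

  unframe< : ∀ {n} → Site n → Site n → FS n
  unframe< onX    onX    = ⊥′
  unframe< onX    _      = ⊤′
  unframe< (at i) (at j) = i <′ j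
  unframe< (at _) onY    = ⊤′
  unframe< _      _      = ⊥′

  unframe= : ∀ {n} → Site n → Site n → FS n
  unframe= onX    onX    = ⊤′
  unframe= onY    onY    = ⊤′
  unframe= (at i) (at j) = i =′ j
  unframe= _      _      = ⊥′

  Empty′ : ∀ {n} → FS n
  Empty′ = ¬′ (∃′ ⊤′)

  IsLast′ : ∀ {n} → FS (suc n)
  IsLast′ = ¬′ (∃′ (fs fz <′ fz))

  -- In x·w·y the marker y sits at position length w + 1.
  EndCongruent′ : ∀ {n} → HasCong ℒ → (m : ℕ) → 1 ≤ m → FS n
  EndCongruent′ hc m q = (Empty′ ∧′ (lit′ ⌊ m ∣? 1 ⌋)) ∨′ (∃′ (IsLast′ ∧′ (Congruent′ hc m q 2 fz)))

  unframeCong : ∀ {n} → HasCong ℒ → (m : ℕ) → 1 ≤ m → Site n → FS n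
  unframeCong hc m q onX    = ⊤′
  unframeCong hc m q (at i) = Congruent′ hc m q 1 i
  unframeCong hc m q onY    = EndCongruent′ hc m q

  withOffset′ : ∀ {n} → FS n → FS n → (ℕ → FS n) → FS n
  withOffset′ a b D = if′ a (if′ b (D 2) (D 1)) (if′ b (D 1) (D 0))

  unframe : ∀ {n n′} → FD n → (Fin n → Site n′) → FS n′
  unframe (letter b v)     τ = unframeLetter b (τ v)
  unframe (u <′ v)         τ = unframe< (τ u) (τ v)
  unframe (u =′ v)         τ = unframe= (τ u) (τ v)
  unframe ⊤′               τ = ⊤′
  unframe (¬′ ψ)           τ = ¬′ (unframe ψ τ)
  unframe (ψ ∧′ χ)         τ = (unframe ψ τ) ∧′ (unframe χ τ)
  unframe (∃′ ψ)           τ =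
    ((unframe ψ (extendSite onX τ)) ∨′ (unframe ψ (extendSite onY τ))) ∨′ (∃′ (unframe ψ (atNew τ)))
  unframe (cong0 hc m q v) τ = unframeCong hc m q (τ v)
  unframe (∃^ hm m q ψ)    τ =
    withOffset′ (unframe ψ (extendSite onX τ)) (unframe ψ (extendSite onY τ))
                (λ e → CountCongruent′ hm m q e (unframe ψ (atNew τ)))

  module _ (w : List (Fin s)) where

    W : ℕ
    W = length w

    framed : List (Fin d)
    framed = x ∷ (map h w ++ [ y ])

    position : ∀ {n} → (Fin n → ℕ) → Site n → ℕ
    position ρ onX    = 0
    position ρ onY    = suc W
    position ρ (at i) = suc (ρ i)

    Bounded : ∀ {n} → (Fin n → ℕ) → Set
    Bounded ρ = ∀ i → ρ i < W

    length-inner : length (map h w ++ [ y ]) ≡ suc W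
    length-inner = trans (length-++ (map h w)) (trans (cong (_+ 1) (length-map h w)) (+-comm W 1))

    any<-framed : ∀ f → any< (length framed) f ≡ f 0 ∨ (any< W (f ∘ suc) ∨ f (suc W))
    any<-framed f = cong (f 0 ∨_) (trans (cong (λ N → any< N (f ∘ suc)) length-inner) (any<-suc W (f ∘ suc)))

    count<-framed : ∀ f → count< (length framed) f ≡ bit (f 0) + (count< W (f ∘ suc) + bit (f (suc W)))
    count<-framed f = cong (bit (f 0) +_) (trans (cong (λ N → count< N (f ∘ suc)) length-inner) (count<-suc W (f ∘ suc)))

    isAt-inner : ∀ i b → i < W → isAt framed (suc i) b ≡ isAt (map h w) i b
    isAt-inner i b i<W = isAt-++ˡ (map h w) [ y ] i b (subst (i <_) (sym (length-map h w)) i<W)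

    isAt-end : ∀ b → isAt framed (suc W) b ≡ ⌊ y ≟ b ⌋
    isAt-end b = trans (cong (λ t → isAt (map h w ++ [ y ]) t b) (sym (trans (+-identityʳ _) (length-map h w))))
                       (isAt-++ʳ (map h w) [ y ] 0 b)

    letterOf-sem : ∀ {n} b (i : Fin n) ρ → Bounded ρ → isAt framed (suc (ρ i)) b ≡ evalℕ w (letterOf b i) ρ
    letterOf-sem b i ρ bd with any? (λ a → h a ≟ b)
    ... | yes (a , refl) = trans (isAt-inner (ρ i) (h a) (bd i)) (isAt-map-injective h h-inj w (ρ i) a)
    ... | no  b∉h        = trans (isAt-inner (ρ i) b (bd i)) (isAt-map-∉ h b (λ a ha≡b → b∉h (a , ha≡b)) w (ρ i))

    unframeLetter-sem : ∀ {n} b (σ : Site n) ρ → Bounded ρ →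
                        isAt framed (position ρ σ) b ≡ evalℕ w (unframeLetter b σ) ρ
    unframeLetter-sem b onX    ρ bd = sym (lit′-sem w _ ρ)
    unframeLetter-sem b onY    ρ bd = trans (isAt-end b) (sym (lit′-sem w _ ρ))
    unframeLetter-sem b (at i) ρ bd = letterOf-sem b i ρ bd

    unframe<-sem : ∀ {n} (σ σ′ : Site n) ρ → Bounded ρ →
                   (position ρ σ <ᵇ position ρ σ′) ≡ evalℕ w (unframe< σ σ′) ρ
    unframe<-sem onX    onX    ρ bd = refl
    unframe<-sem onX    onY    ρ bd = refl
    unframe<-sem onX    (at _) ρ bd = refl
    unframe<-sem (at i) (at j) ρ bd = refl
    unframe<-sem (at i) onY    ρ bd = <⇒<ᵇ≡true (s<s (bd i))
    unframe<-sem (at _) onX    ρ bd = refl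
    unframe<-sem onY    onX    ρ bd = refl
    unframe<-sem onY    onY    ρ bd = ≤⇒<ᵇ≡false {W} ≤-refl
    unframe<-sem onY    (at j) ρ bd = ≤⇒<ᵇ≡false (<⇒≤ (bd j))

    unframe=-sem : ∀ {n} (σ σ′ : Site n) ρ → Bounded ρ →
                   (position ρ σ ≡ᵇ position ρ σ′) ≡ evalℕ w (unframe= σ σ′) ρ
    unframe=-sem onX    onX    ρ bd = refl
    unframe=-sem onX    onY    ρ bd = refl
    unframe=-sem onX    (at _) ρ bd = refl
    unframe=-sem onY    onX    ρ bd = refl
    unframe=-sem onY    onY    ρ bd = ≡ᵇ-refl W
    unframe=-sem onY    (at j) ρ bd = ≢⇒≡ᵇ≡false (λ W≡j → <-irrefl (sym W≡j) (bd j))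
    unframe=-sem (at _) onX    ρ bd = refl
    unframe=-sem (at i) onY    ρ bd = ≢⇒≡ᵇ≡false (λ i≡W → <-irrefl i≡W (bd i))
    unframe=-sem (at i) (at j) ρ bd = refl

    IsLast′-sem : ∀ {n} (ρ : Fin (suc n) → ℕ) → ρ fz < W → evalℕ w IsLast′ ρ ≡ true ⇔ suc (ρ fz) ≡ W
    IsLast′-sem ρ ℓ<W = mk⇔ fw bw
      where
      fw : evalℕ w IsLast′ ρ ≡ true → suc (ρ fz) ≡ W
      fw e with m≤n⇒m<n∨m≡n ℓ<W
      ... | inj₂ sℓ≡W = sℓ≡W
      ... | inj₁ sℓ<W = ⊥-elim (not-elim e (any<-intro W (suc (ρ fz)) sℓ<W (<⇒<ᵇ≡true (n<1+n (ρ fz)))))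
      bw : suc (ρ fz) ≡ W → evalℕ w IsLast′ ρ ≡ true
      bw sℓ≡W = not-intro λ e → let (u , u<W , ℓ<u) = any<-elim W e
                                in <⇒≱ (<ᵇ≡true⇒< ℓ<u) (≤-pred (subst (u <_) (sym sℓ≡W) u<W))

    EndCongruent′-sem : ∀ {n} hc m (q : 1 ≤ m) (ρ : Fin n → ℕ) →
                        evalℕ w (EndCongruent′ hc m q) ρ ≡ true ⇔ m ∣ suc W
    EndCongruent′-sem hc m q ρ = mk⇔ fw bw
      where
      empty = Empty′ ∧′ (lit′ ⌊ m ∣? 1 ⌋)
      last : FS _
      last = IsLast′ ∧′ (Congruent′ hc m q 2 fz)
      fw : evalℕ w (EndCongruent′ hc m q) ρ ≡ true → m ∣ suc W
      empty⇒W≡0 : evalℕ w Empty′ ρ ≡ true → W ≡ 0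
      empty⇒W≡0 e with W in W≡
      ... | zero  = refl
      ... | suc _ = ⊥-elim (not-elim e refl)
      fw e with ∨-elim (trans (sym (∨′-sem w empty (∃′ last) ρ)) e)
      ... | inj₁ e′ = subst (λ t → m ∣ suc t) (sym (empty⇒W≡0 (∧-elimˡ e′)))
                            (toWitnessᵇ (m ∣? 1) (trans (sym (lit′-sem w _ ρ)) (∧-elimʳ {evalℕ w Empty′ ρ} e′)))
      ... | inj₂ e′ with any<-elim W e′
      ...   | ℓ , ℓ<W , at-ℓ =
        subst (m ∣_) ℓ+2≡ (to (Congruent′-sem hc w m q 2 fz (extendℕ ℓ ρ) ℓ<W) (∧-elimʳ at-ℓ))
        where
        ℓ+2≡ : ℓ + 2 ≡ suc W
        ℓ+2≡ = trans (+-comm ℓ 2) (cong suc (to (IsLast′-sem (extendℕ ℓ ρ) ℓ<W) (∧-elimˡ at-ℓ)))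
      bw : m ∣ suc W → evalℕ w (EndCongruent′ hc m q) ρ ≡ true
      zero⊎suc : ∀ n → n ≡ 0 ⊎ ∃[ ℓ ] (n ≡ suc ℓ)
      zero⊎suc zero    = inj₁ refl
      zero⊎suc (suc ℓ) = inj₂ (ℓ , refl)
      bw m∣sW with zero⊎suc W
      ... | inj₁ W≡0 = trans (∨′-sem w empty (∃′ last) ρ)
                         (∨-introˡ (∧-intro (cong not (cong (λ N → any< N (λ _ → true)) W≡0))
                                            (trans (lit′-sem w _ ρ)
                                                   (fromWitnessᵇ (m ∣? 1) (subst (λ t → m ∣ suc t) W≡0 m∣sW)))))
      ... | inj₂ (ℓ , W≡sℓ) = trans (∨′-sem w empty (∃′ last) ρ) (∨-introʳ {evalℕ w empty ρ}
                                (any<-intro W ℓ ℓ<W (∧-intro (from (IsLast′-sem (extendℕ ℓ ρ) ℓ<W) (sym W≡sℓ))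
                                  (from (Congruent′-sem hc w m q 2 fz (extendℕ ℓ ρ) ℓ<W)
                                        (subst (m ∣_) (sym (trans (+-comm ℓ 2) (cong suc (sym W≡sℓ)))) m∣sW)))))
        where
        ℓ<W : ℓ < W
        ℓ<W = subst (ℓ <_) (sym W≡sℓ) (n<1+n ℓ)

    unframeCong-sem : ∀ {n} hc m (q : 1 ≤ m) (σ : Site n) ρ → Bounded ρ →
                      ⌊ m ∣? position ρ σ ⌋ ≡ evalℕ w (unframeCong hc m q σ) ρ
    unframeCong-sem hc m q onX    ρ bd = fromWitnessᵇ (m ∣? 0) (m ∣0)
    unframeCong-sem hc m q (at i) ρ bd = sym (≡⌊⌋ (m ∣? suc (ρ i)) congruent)
      where
      congruent : evalℕ w (Congruent′ hc m q 1 i) ρ ≡ true ⇔ m ∣ suc (ρ i)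
      congruent = subst (λ t → evalℕ w (Congruent′ hc m q 1 i) ρ ≡ true ⇔ m ∣ t) (+-comm (ρ i) 1)
                        (Congruent′-sem hc w m q 1 i ρ (bd i))
    unframeCong-sem hc m q onY    ρ bd = sym (≡⌊⌋ (m ∣? suc W) (EndCongruent′-sem hc m q ρ))

    withOffset′-sem : ∀ {n} (a b : FS n) D ρ →
                      evalℕ w (withOffset′ a b D) ρ ≡ evalℕ w (D (bit (evalℕ w a ρ) + bit (evalℕ w b ρ))) ρ
    withOffset′-sem a b D ρ
      rewrite if′-sem w a (if′ b (D 2) (D 1)) (if′ b (D 1) (D 0)) ρ
            | if′-sem w b (D 2) (D 1) ρ | if′-sem w b (D 1) (D 0) ρ
      with evalℕ w a ρ | evalℕ w b ρ
    ... | true  | true  = refl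
    ... | true  | false = refl
    ... | false | true  = refl
    ... | false | false = refl

    extendℕ-onX : ∀ {n n′} (τ : Fin n → Site n′) ρ i →
                  extendℕ 0 (position ρ ∘ τ) i ≡ position ρ (extendSite onX τ i)
    extendℕ-onX τ ρ fz     = refl
    extendℕ-onX τ ρ (fs i) = refl

    extendℕ-onY : ∀ {n n′} (τ : Fin n → Site n′) ρ i →
                  extendℕ (suc W) (position ρ ∘ τ) i ≡ position ρ (extendSite onY τ i)
    extendℕ-onY τ ρ fz     = refl
    extendℕ-onY τ ρ (fs i) = refl

    extendℕ-atNew : ∀ {n n′} (τ : Fin n → Site n′) ρ t i →
                    extendℕ (suc t) (position ρ ∘ τ) i ≡ position (extendℕ t ρ) (atNew τ i)
    extendℕ-atNew τ ρ t fz     = refl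
    extendℕ-atNew τ ρ t (fs i) = position-weaken (τ i)
      where
      position-weaken : ∀ σ → position ρ σ ≡ position (extendℕ t ρ) (weakenSite σ)
      position-weaken onX    = refl
      position-weaken onY    = refl
      position-weaken (at j) = refl

    bounded-extend : ∀ {n} t (ρ : Fin n → ℕ) → t < W → Bounded ρ → Bounded (extendℕ t ρ)
    bounded-extend t ρ t<W bd fz     = t<W
    bounded-extend t ρ t<W bd (fs i) = bd i

    Unframes : ∀ {n} → FD n → Set
    Unframes {n} ψ = ∀ {n′} (τ : Fin n → Site n′) ρ → Bounded ρ →
                     evalℕ framed ψ (position ρ ∘ τ) ≡ evalℕ w (unframe ψ τ) ρ

    module Quantified {n n′} (ψ : FD (suc n)) (ψ-ok : Unframes ψ) (τ : Fin n → Site n′) (ρ : Fin n′ → ℕ)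
                      (bd : Bounded ρ) where

      body : ℕ → Bool
      body i = evalℕ framed ψ (extendℕ i (position ρ ∘ τ))

      a b : FS n′
      a = unframe ψ (extendSite onX τ)
      b = unframe ψ (extendSite onY τ)

      c : FS (suc n′)
      c = unframe ψ (atNew τ)

      body-onX : body 0 ≡ evalℕ w a ρ
      body-onX = trans (evalℕ-cong framed ψ (extendℕ-onX τ ρ)) (ψ-ok (extendSite onX τ) ρ bd)

      body-onY : body (suc W) ≡ evalℕ w b ρ
      body-onY = trans (evalℕ-cong framed ψ (extendℕ-onY τ ρ)) (ψ-ok (extendSite onY τ) ρ bd)

      body-inner : ∀ t → t < W → body (suc t) ≡ holdsAt w c ρ t
      body-inner t t<W = trans (evalℕ-cong framed ψ (extendℕ-atNew τ ρ t))
                               (ψ-ok (atNew τ) (extendℕ t ρ) (bounded-extend t ρ t<W bd))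

      ∃′-unframes : evalℕ framed (∃′ ψ) (position ρ ∘ τ) ≡ evalℕ w (unframe (∃′ ψ) τ) ρ
      ∃′-unframes = begin
        any< (length framed) body                          ≡⟨ any<-framed body ⟩
        body 0 ∨ (any< W (body ∘ suc) ∨ body (suc W))       ≡⟨ cong₂ _∨_ body-onX
                                                                (cong₂ _∨_ (any<-cong W body-inner) body-onY) ⟩
        evalℕ w a ρ ∨ (evalℕ w (∃′ c) ρ ∨ evalℕ w b ρ)      ≡⟨ cong (evalℕ w a ρ ∨_) (∨-comm _ (evalℕ w b ρ)) ⟩
        evalℕ w a ρ ∨ (evalℕ w b ρ ∨ evalℕ w (∃′ c) ρ)      ≡⟨ sym (∨-assoc (evalℕ w a ρ) _ _) ⟩
        (evalℕ w a ρ ∨ evalℕ w b ρ) ∨ evalℕ w (∃′ c) ρ      ≡⟨ sym (trans (∨′-sem w (a ∨′ b) (∃′ c) ρ)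
                                                                (cong (_∨ evalℕ w (∃′ c) ρ) (∨′-sem w a b ρ))) ⟩
        evalℕ w (unframe (∃′ ψ) τ) ρ                        ∎

      offset : ℕ
      offset = bit (evalℕ w a ρ) + bit (evalℕ w b ρ)

      count-framed : count< (length framed) body ≡ count w c ρ + offset
      count-framed = begin
        count< (length framed) body                                  ≡⟨ count<-framed body ⟩
        bit (body 0) + (count< W (body ∘ suc) + bit (body (suc W)))  ≡⟨ cong₂ (λ p r → bit p + r) body-onX
                                                                         (cong₂ (λ r u → r + bit u) (count<-cong W body-inner) body-onY) ⟩
        α + (count w c ρ + β)                                        ≡⟨ sym (+-assoc α _ β) ⟩
        α + count w c ρ + β                                          ≡⟨ cong (_+ β) (+-comm α _) ⟩
        count w c ρ + α + β                                          ≡⟨ +-assoc (count w c ρ) α β ⟩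
        count w c ρ + offset                                         ∎
        where
        α = bit (evalℕ w a ρ)
        β = bit (evalℕ w b ρ)

      ∃^-unframes : ∀ hm m q → evalℕ framed (∃^ hm m q ψ) (position ρ ∘ τ) ≡ evalℕ w (unframe (∃^ hm m q ψ) τ) ρ
      ∃^-unframes hm m q = begin
        ⌊ m ∣? count< (length framed) body ⌋            ≡⟨ cong (λ t → ⌊ m ∣? t ⌋) count-framed ⟩
        ⌊ m ∣? count w c ρ + offset ⌋                   ≡⟨ sym (CountCongruent′-sem hm w m q offset c ρ) ⟩
        evalℕ w (CountCongruent′ hm m q offset c) ρ     ≡⟨ sym (withOffset′-sem a b (λ e → CountCongruent′ hm m q e c) ρ) ⟩
        evalℕ w (unframe (∃^ hm m q ψ) τ) ρ             ∎

    unframe-sem : ∀ {n} (ψ : FD n) → Unframes ψ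
    unframe-sem (letter b v)     τ ρ bd = unframeLetter-sem b (τ v) ρ bd
    unframe-sem (u <′ v)         τ ρ bd = unframe<-sem (τ u) (τ v) ρ bd
    unframe-sem (u =′ v)         τ ρ bd = unframe=-sem (τ u) (τ v) ρ bd
    unframe-sem ⊤′               τ ρ bd = refl
    unframe-sem (¬′ ψ)           τ ρ bd = cong not (unframe-sem ψ τ ρ bd)
    unframe-sem (ψ ∧′ χ)         τ ρ bd = cong₂ _∧_ (unframe-sem ψ τ ρ bd) (unframe-sem χ τ ρ bd)
    unframe-sem (cong0 hc m q v) τ ρ bd = unframeCong-sem hc m q (τ v) ρ bd
    unframe-sem (∃′ ψ)           τ ρ bd = Quantified.∃′-unframes ψ (unframe-sem ψ) τ ρ bd
    unframe-sem (∃^ hm m q ψ)    τ ρ bd = Quantified.∃^-unframes ψ (unframe-sem ψ) τ ρ bd hm m q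

+-cancelˡ-<ᵇ : ∀ c a b → (c + a <ᵇ c + b) ≡ (a <ᵇ b)
+-cancelˡ-<ᵇ c a b = truth-ext (λ e → <⇒<ᵇ≡true (+-cancelˡ-< c a b (<ᵇ≡true⇒< e)))
                               (λ e → <⇒<ᵇ≡true (+-monoʳ-< c (<ᵇ≡true⇒< e)))

+-cancelˡ-≡ᵇ : ∀ c a b → (c + a ≡ᵇ c + b) ≡ (a ≡ᵇ b)
+-cancelˡ-≡ᵇ c a b = truth-ext (λ e → ≡⇒≡ᵇ≡true (+-cancelˡ-≡ c a b (≡ᵇ≡true⇒≡ e)))
                               (λ e → ≡⇒≡ᵇ≡true (cong (c +_) (≡ᵇ≡true⇒≡ e)))

module Relativise {ℒ : Logic} {s d : ℕ} (h : Fin s → Fin d) where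

  FS : ℕ → Set
  FS n = Formula ℒ (Fin s) n

  FD : ℕ → Set
  FD n = Formula ℒ (Fin d) n

  between′ : ∀ {m} → Fin m → Fin m → FD (suc m) → FD (suc m)
  between′ I J χ = ((fs I) <′ fz) ∧′ ((fz <′ (fs J)) ∧′ χ)

  -- I and J hold the positions enclosing the factor; σ says which variable of
  -- the result stands for each variable of φ.
  relativise : ∀ {n m} → FS n → (Fin n → Fin m) → Fin m → Fin m → FD m
  relativise (letter a v)     σ I J = letter (h a) (σ v)
  relativise (u <′ v)         σ I J = σ u <′ σ v
  relativise (u =′ v)         σ I J = σ u =′ σ v
  relativise ⊤′               σ I J = ⊤′
  relativise (¬′ φ)           σ I J = ¬′ (relativise φ σ I J)
  relativise (φ ∧′ ψ)         σ I J = (relativise φ σ I J) ∧′ (relativise ψ σ I J)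
  relativise (∃′ φ)           σ I J = ∃′ (between′ I J (relativise φ (lift σ) (fs I) (fs J)))
  relativise (cong0 hc m q v) σ I J = GapCongruent′ hc m q I (σ v)
  relativise (∃^ hm m q φ)    σ I J = ∃^ hm m q (between′ I J (relativise φ (lift σ) (fs I) (fs J)))

  module _ (u : List (Fin d)) (w : List (Fin s)) (i : ℕ)
           (letters : ∀ t a → t < length w → isAt u (suc i + t) (h a) ≡ isAt w t a)
           (fits : suc i + length w ≤ length u) where

    record Placed {n m} (σ : Fin n → Fin m) (I J : Fin m) (ρ′ : Fin m → ℕ) (ρ : Fin n → ℕ) : Set where
      field
        at-I    : ρ′ I ≡ i
        at-J    : ρ′ J ≡ suc i + length w
        shifted : ∀ v → ρ′ (σ v) ≡ suc i + ρ v
        bounded : ∀ v → ρ v < length w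

    placed-extend : ∀ {n m σ I J ρ′ ρ} → Placed {n} {m} σ I J ρ′ ρ → ∀ t → t < length w →
                    Placed (lift σ) (fs I) (fs J) (extendℕ (suc i + t) ρ′) (extendℕ t ρ)
    placed-extend p t t<w = record
      { at-I    = Placed.at-I p
      ; at-J    = Placed.at-J p
      ; shifted = λ { fz → refl ; (fs v) → Placed.shifted p v }
      ; bounded = λ { fz → t<w ; (fs v) → Placed.bounded p v }
      }

    Relativises : ∀ {n} → FS n → Set
    Relativises {n} φ = ∀ {m} σ (I J : Fin m) ρ′ ρ → Placed σ I J ρ′ ρ →
                        evalℕ u (relativise φ σ I J) ρ′ ≡ evalℕ w φ ρ

    module Guarded {n m} (φ : FS (suc n)) (φ-ok : Relativises φ) (σ : Fin n → Fin m) (I J : Fin m)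
                   (ρ′ : Fin m → ℕ) (ρ : Fin n → ℕ) (p : Placed σ I J ρ′ ρ) where

      guarded : ℕ → Bool
      guarded z = evalℕ u (between′ I J (relativise φ (lift σ) (fs I) (fs J))) (extendℕ z ρ′)

      before : ∀ z → z < suc i → guarded z ≡ false
      before z z≤i rewrite Placed.at-I p with ≤⇒<ᵇ≡false {i} {z} (≤-pred z≤i)
      ... | i<z≡false rewrite i<z≡false = refl

      after : ∀ z → suc i + length w ≤ z → guarded z ≡ false
      after z J≤z rewrite Placed.at-I p | Placed.at-J p | ≤⇒<ᵇ≡false J≤z with i <ᵇ z
      ... | true  = refl
      ... | false = refl

      inside : ∀ t → t < length w → guarded (suc i + t) ≡ evalℕ w φ (extendℕ t ρ)
      inside t t<w rewrite Placed.at-I p | Placed.at-J p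
                         | <⇒<ᵇ≡true {i} {suc i + t} (s≤s (m≤m+n i t))
                         | <⇒<ᵇ≡true {suc i + t} {suc i + length w} (+-monoʳ-< (suc i) t<w) =
        φ-ok (lift σ) (fs I) (fs J) (extendℕ (suc i + t) ρ′) (extendℕ t ρ) (placed-extend p t t<w)

    relativise-sem : ∀ {n} (φ : FS n) → Relativises φ
    relativise-sem (letter a v)     σ I J ρ′ ρ p =
      trans (cong (λ t → isAt u t (h a)) (Placed.shifted p v)) (letters (ρ v) a (Placed.bounded p v))
    relativise-sem (x <′ y)         σ I J ρ′ ρ p =
      trans (cong₂ _<ᵇ_ (Placed.shifted p x) (Placed.shifted p y)) (+-cancelˡ-<ᵇ (suc i) (ρ x) (ρ y))
    relativise-sem (x =′ y)         σ I J ρ′ ρ p =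
      trans (cong₂ _≡ᵇ_ (Placed.shifted p x) (Placed.shifted p y)) (+-cancelˡ-≡ᵇ (suc i) (ρ x) (ρ y))
    relativise-sem ⊤′               σ I J ρ′ ρ p = refl
    relativise-sem (¬′ φ)           σ I J ρ′ ρ p = cong not (relativise-sem φ σ I J ρ′ ρ p)
    relativise-sem (φ ∧′ ψ)         σ I J ρ′ ρ p =
      cong₂ _∧_ (relativise-sem φ σ I J ρ′ ρ p) (relativise-sem ψ σ I J ρ′ ρ p)
    relativise-sem (cong0 hc m q v) σ I J ρ′ ρ p =
      ≡⌊⌋ (m ∣? ρ v) (subst (λ t → _ ≡ true ⇔ m ∣ t) gap (GapCongruent′-sem hc u m q I (σ v) ρ′ I<v v<u))
      where
      open Placed p
      I<v : ρ′ I < ρ′ (σ v)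
      I<v = subst₂ _<_ (sym at-I) (sym (shifted v)) (s≤s (m≤m+n i (ρ v)))
      v<u : ρ′ (σ v) < length u
      v<u = subst (_< length u) (sym (shifted v)) (<-≤-trans (+-monoʳ-< (suc i) (bounded v)) fits)
      gap : ρ′ (σ v) ∸ suc (ρ′ I) ≡ ρ v
      gap = trans (cong₂ _∸_ (shifted v) (cong suc at-I)) (m+n∸m≡n (suc i) (ρ v))
    relativise-sem (∃′ φ)           σ I J ρ′ ρ p =
      trans (any<-window (suc i) (length w) (length u) guarded fits before after) (any<-cong (length w) inside)
      where open Guarded φ (relativise-sem φ) σ I J ρ′ ρ p
    relativise-sem (∃^ hm m q φ)    σ I J ρ′ ρ p = cong (λ c → ⌊ m ∣? c ⌋)
      (trans (count<-window (suc i) (length w) (length u) guarded fits before after) (count<-cong (length w) inside))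
      where open Guarded φ (relativise-sem φ) σ I J ρ′ ρ p

InImage : ∀ {s d} → (Fin s → Fin d) → List (Fin d) → Set
InImage f u = ∀ z → z < length u → ∃[ a ] (isAt u z (f a) ≡ true)

isAt⇒<length : ∀ {k} (u : List (Fin k)) z c → isAt u z c ≡ true → z < length u
isAt⇒<length (b ∷ u) zero    c _ = z<s
isAt⇒<length (b ∷ u) (suc z) c e = s<s (isAt⇒<length u z c e)

isAt⇒split : ∀ {k} (u : List (Fin k)) z c → isAt u z c ≡ true → ∃[ p ] ∃[ q ] (u ≡ p ++ c ∷ q × length p ≡ z)
isAt⇒split (b ∷ u) zero    c e with refl ← toWitnessᵇ (b ≟ c) e = [] , u , refl , refl
isAt⇒split (b ∷ u) (suc z) c e with isAt⇒split u z c e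
... | p , q , refl , refl = b ∷ p , q , refl , refl

InImage-map : ∀ {s d} (f : Fin s → Fin d) w → InImage f (map f w)
InImage-map f (a ∷ w) zero    _         = a , fromWitnessᵇ (f a ≟ f a) refl
InImage-map f (a ∷ w) (suc z) (s<s z<w) = InImage-map f w z z<w

InImage⇒map : ∀ {s d} (f : Fin s → Fin d) u → InImage f u → ∃[ w ] (u ≡ map f w)
InImage⇒map f []      _   = [] , refl
InImage⇒map f (c ∷ u) img with img 0 z<s | InImage⇒map f u (λ z z<u → img (suc z) (s<s z<u))
... | a , c≡fa | w , refl = a ∷ w , cong (_∷ map f w) (toWitnessᵇ (c ≟ f a) c≡fa)

InImage-++ˡ : ∀ {s d} (f : Fin s → Fin d) p q → InImage f (p ++ q) → InImage f p
InImage-++ˡ f p q img z z<p with img z (<-≤-trans z<p (subst (length p ≤_) (sym (length-++ p)) (m≤m+n _ _)))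
... | a , at-z = a , trans (sym (isAt-++ˡ p q z (f a) z<p)) at-z

InImage-++ʳ : ∀ {s d} (f : Fin s → Fin d) p q → InImage f (p ++ q) → InImage f q
InImage-++ʳ f p q img z z<q with img (length p + z) (subst (length p + z <_) (sym (length-++ p)) (+-monoʳ-< (length p) z<q))
... | a , at-z = a , trans (sym (isAt-++ʳ p q z (f a))) at-z

InImage-tail : ∀ {s d} (f : Fin s → Fin d) c u → InImage f (c ∷ u) → InImage f u
InImage-tail f c u img z z<u = img (suc z) (s<s z<u)

isAt-after : ∀ {k} (P : List (Fin k)) c q t b → isAt (P ++ c ∷ q) (suc (length P) + t) b ≡ isAt q t b
isAt-after P c q t b = trans (cong (λ z → isAt (P ++ c ∷ q) z b) (sym (+-suc (length P) t))) (isAt-++ʳ P _ (suc t) b)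

module Frame {s d : ℕ} (h : Fin s → Fin d) (h-inj : Injective _≡_ _≡_ h)
             (P : List (Fin d)) (c c′ : Fin d) (w : List (Fin s)) (R : List (Fin d)) where

  U : List (Fin d)
  U = P ++ c ∷ (map h w ++ c′ ∷ R)

  i : ℕ
  i = length P

  j : ℕ
  j = suc i + length w

  letters : ∀ t a → t < length w → isAt U (suc i + t) (h a) ≡ isAt w t a
  letters t a t<w = begin
    isAt U (suc i + t) (h a)                 ≡⟨ isAt-after P c _ t (h a) ⟩
    isAt (map h w ++ c′ ∷ R) t (h a)         ≡⟨ isAt-++ˡ (map h w) _ t (h a) (subst (t <_) (sym (length-map h w)) t<w) ⟩
    isAt (map h w) t (h a)                   ≡⟨ isAt-map-injective h h-inj w t a ⟩
    isAt w t a                               ∎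

  length-U : length U ≡ i + suc (length w + suc (length R))
  length-U = trans (length-++ P) (cong (λ t → i + suc t)
                   (trans (length-++ (map h w)) (cong (_+ suc (length R)) (length-map h w))))

  fits : j ≤ length U
  fits = subst₂ _≤_ (+-suc i (length w)) (sym length-U) (+-monoʳ-≤ i (s≤s (m≤m+n (length w) _)))

  at-i : isAt U i c ≡ true
  at-i = trans (cong (λ z → isAt U z c) (sym (+-identityʳ i))) (trans (isAt-++ʳ P _ 0 c) (fromWitnessᵇ (c ≟ c) refl))

  at-j : isAt U j c′ ≡ true
  at-j = begin
    isAt U (suc i + length w) c′                        ≡⟨ isAt-after P c _ (length w) c′ ⟩
    isAt (map h w ++ c′ ∷ R) (length w) c′              ≡⟨ cong (λ t → isAt (map h w ++ c′ ∷ R) t c′)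
                                                              (sym (trans (+-identityʳ _) (length-map h w))) ⟩
    isAt (map h w ++ c′ ∷ R) (length (map h w) + 0) c′  ≡⟨ isAt-++ʳ (map h w) _ 0 c′ ⟩
    ⌊ c′ ≟ c′ ⌋                                         ≡⟨ fromWitnessᵇ (c′ ≟ c′) refl ⟩
    true                                                ∎

  between-in-image : ∀ z → i < z → z < j → ∃[ a ] (isAt U z (h a) ≡ true)
  between-in-image z i<z z<j with m≤n⇒∃[o]m+o≡n i<z
  ... | t , refl with +-cancelˡ-< (suc i) t (length w) z<j
  ...   | t<w with InImage-map h w t (subst (t <_) (sym (length-map h w)) t<w)
  ...     | a , at-t = a , trans (letters t a t<w) (trans (sym (isAt-map-injective h h-inj w t a)) at-t)

module Framing {ℒ : Logic} {s g d : ℕ} (ι : Fin s → Fin g) (κ : Fin g → Fin d)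
               (ι-inj : Injective _≡_ _≡_ ι) (κ-inj : Injective _≡_ _≡_ κ)
               (x y : Fin g) (x∉ι : ∀ a → ι a ≢ x) (y∉ι : ∀ a → ι a ≢ y) (L : Language s) where

  h : Fin s → Fin d
  h = κ ∘ ι

  h-inj : Injective _≡_ _≡_ h
  h-inj = ι-inj ∘ κ-inj

  open Unframe {ℒ} h h-inj (κ x) (κ y) using (unframe; framed; unframe-sem)
  open Relativise {ℒ} h using (relativise; relativise-sem)

  FS : ℕ → Set
  FS n = Formula ℒ (Fin s) n

  FD : ℕ → Set
  FD n = Formula ℒ (Fin d) n

  map-framed : ∀ w₁ w w₂ → map κ (w₁ ++ x ∷ (map ι w ++ y ∷ w₂)) ≡
                            Frame.U h h-inj (map κ w₁) (κ x) (κ y) w (map κ w₂)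
  map-framed w₁ w w₂ = trans (map-++ κ w₁ _) (cong (λ t → map κ w₁ ++ κ x ∷ t)
                             (trans (map-++ κ (map ι w) (y ∷ w₂)) (cong (_++ κ y ∷ map κ w₂) (sym (map-∘ w)))))

  ι[w]y-cancel : ∀ w w′ r → map ι w ++ y ∷ [] ≡ map ι w′ ++ y ∷ r → w ≡ w′
  ι[w]y-cancel []      []       r eq = refl
  ι[w]y-cancel []      (a ∷ w′) r eq = ⊥-elim (y∉ι a (sym (∷-injectiveˡ eq)))
  ι[w]y-cancel (a ∷ w) []       r eq = ⊥-elim (y∉ι a (∷-injectiveˡ eq))
  ι[w]y-cancel (a ∷ w) (_ ∷ w′) r eq = cong₂ _∷_ (ι-inj (∷-injectiveˡ eq)) (ι[w]y-cancel w w′ r (∷-injectiveʳ eq))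

  x∉ι[w]y : ∀ w p q r → map ι w ++ y ∷ [] ≢ p ++ x ∷ (q ++ y ∷ r)
  x∉ι[w]y []      []          []      r ()
  x∉ι[w]y []      []          (_ ∷ _) r ()
  x∉ι[w]y []      (_ ∷ [])    q       r ()
  x∉ι[w]y []      (_ ∷ _ ∷ _) q       r ()
  x∉ι[w]y (a ∷ w) []          q       r eq = x∉ι a (∷-injectiveˡ eq)
  x∉ι[w]y (a ∷ w) (_ ∷ p)     q       r eq = x∉ι[w]y w p q r (∷-injectiveʳ eq)

  framed∈L′⇔ : ∀ w → L′ ι κ x y L (framed w) ⇔ L w
  framed∈L′⇔ w = mk⇔ fw (λ Lw → [] , w , [] , Lw , framed≡)
    where
    framed≡ : framed w ≡ map κ (x ∷ (map ι w ++ y ∷ []))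
    framed≡ = cong (κ x ∷_) (sym (trans (map-++ κ (map ι w) (y ∷ [])) (cong (_++ κ y ∷ []) (sym (map-∘ w)))))
    fw : L′ ι κ x y L (framed w) → L w
    fw (w₁ , w′ , w₂ , Lw′ , eq) with map-injective κ-inj (trans (sym framed≡) eq)
    ... | eq′ with w₁
    ...   | []      = subst L (sym (ι[w]y-cancel w w′ w₂ (∷-injectiveʳ eq′))) Lw′
    ...   | _ ∷ w₁′ = ⊥-elim (x∉ι[w]y w w₁′ (map ι w′) w₂ (∷-injectiveʳ eq′))

  unframe-definable : Definable ℒ d (L′ ι κ x y L) → Definable ℒ s L
  unframe-definable (ψ , ψ-def) = unframe ψ (λ ()) , λ w →
    subst (λ b → L w ⇔ b ≡ true) (⊨-framed w) (⇔-trans (⇔-sym (framed∈L′⇔ w)) (ψ-def (framed w)))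
    where
    ⊨-framed : ∀ w → _⊨_ _≟_ (framed w) ψ ≡ _⊨_ _≟_ w (unframe ψ (λ ()))
    ⊨-framed w = begin
      _⊨_ _≟_ (framed w) ψ               ≡⟨ ⊨≡evalℕ (framed w) ψ ⟩
      evalℕ (framed w) ψ ρ₀              ≡⟨ trans (evalℕ-cong (framed w) ψ (λ ())) (unframe-sem w ψ (λ ()) ρ₀ (λ ())) ⟩
      evalℕ w (unframe ψ (λ ())) ρ₀      ≡⟨ sym (⊨≡evalℕ w (unframe ψ (λ ()))) ⟩
      _⊨_ _≟_ w (unframe ψ (λ ()))       ∎

  InΣ′ : ∀ {n} → Fin n → FD n
  InΣ′ v = ⋁Fin′ s (λ a → letter (h a) v)

  InΓ′ : ∀ {n} → Fin n → FD n
  InΓ′ v = ⋁Fin′ g (λ c → letter (κ c) v)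

  -- In the formulas below with two free variables, fs fz holds the position of x and fz that of y.
  Between′ : FD 3
  Between′ = (fs (fs fz) <′ fz) ∧′ (fz <′ fs fz)

  OnlyΣBetween′ : FD 2
  OnlyΣBetween′ = ∀′ (Between′ ⇒′ InΣ′ fz)

  Factor′ : FS 0 → FD 2
  Factor′ φ = (fs fz <′ fz) ∧′ ((letter (κ x) (fs fz)) ∧′ ((letter (κ y) fz) ∧′
              (OnlyΣBetween′ ∧′ (relativise φ (λ ()) (fs fz) fz))))

  frame : FS 0 → FD 0
  frame φ = (∃′ (∃′ (Factor′ φ))) ∧′ (∀′ (InΓ′ fz))

  positions : ℕ → ℕ → Fin 2 → ℕ
  positions i j = extendℕ j (extendℕ i ρ₀)

  module _ (u : List (Fin d)) where

    OnlyΓ-sem : evalℕ u (∀′ (InΓ′ fz)) ρ₀ ≡ true ⇔ InImage κ u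
    OnlyΓ-sem = ⇔-trans (∀′-sem u (InΓ′ fz) ρ₀)
      (mk⇔ (λ all z z<u → to (⋁Fin′-sem u g (λ c → letter (κ c) fz) (extendℕ z ρ₀)) (all z z<u))
           (λ img z z<u → from (⋁Fin′-sem u g (λ c → letter (κ c) fz) (extendℕ z ρ₀)) (img z z<u)))

    OnlyΣBetween-sem : ∀ i j → evalℕ u OnlyΣBetween′ (positions i j) ≡ true ⇔
                       (∀ z → z < length u → i < z → z < j → ∃[ a ] (isAt u z (h a) ≡ true))
    OnlyΣBetween-sem i j = ⇔-trans (∀′-sem u (Between′ ⇒′ InΣ′ fz) (positions i j)) (mk⇔ fw bw)
      where
      ρ : ℕ → Fin 3 → ℕ
      ρ z = extendℕ z (positions i j)
      fw : (∀ z → z < length u → holdsAt u (Between′ ⇒′ InΣ′ fz) (positions i j) z ≡ true) →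
           ∀ z → z < length u → i < z → z < j → ∃[ a ] (isAt u z (h a) ≡ true)
      fw all z z<u i<z z<j = to (⋁Fin′-sem u s (λ a → letter (h a) fz) (ρ z))
        (to (⇒′-sem u Between′ (InΣ′ fz) (ρ z)) (all z z<u) (∧-intro (<⇒<ᵇ≡true i<z) (<⇒<ᵇ≡true z<j)))
      bw : (∀ z → z < length u → i < z → z < j → ∃[ a ] (isAt u z (h a) ≡ true)) →
           ∀ z → z < length u → holdsAt u (Between′ ⇒′ InΣ′ fz) (positions i j) z ≡ true
      bw between z z<u = from (⇒′-sem u Between′ (InΣ′ fz) (ρ z)) λ e →
        from (⋁Fin′-sem u s (λ a → letter (h a) fz) (ρ z))
             (between z z<u (<ᵇ≡true⇒< (∧-elimˡ e)) (<ᵇ≡true⇒< (∧-elimʳ {i <ᵇ z} e)))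

  module Framed (w₁ : List (Fin g)) (w : List (Fin s)) (w₂ : List (Fin g)) where

    open Frame h h-inj (map κ w₁) (κ x) (κ y) w (map κ w₂) public

    relativise-framed : ∀ φ → evalℕ U (relativise φ (λ ()) (fs fz) fz) (positions i j) ≡ evalℕ w φ ρ₀
    relativise-framed φ = relativise-sem U w i letters fits φ (λ ()) (fs fz) fz (positions i j) ρ₀
      record { at-I = refl ; at-J = refl ; shifted = λ () ; bounded = λ () }

    factor-holds : ∀ φ → evalℕ w φ ρ₀ ≡ true → evalℕ U (Factor′ φ) (positions i j) ≡ true
    factor-holds φ φw = ∧-intro (<⇒<ᵇ≡true (s≤s (m≤m+n i (length w))))
      (∧-intro at-i (∧-intro at-j (∧-intro (from (OnlyΣBetween-sem U i j) (λ z _ → between-in-image z))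
                                           (trans (relativise-framed φ) φw))))

  preimages : ∀ P M R → InImage κ (P ++ κ x ∷ (M ++ κ y ∷ R)) →
              (∀ z → length P < z → z < suc (length P) + length M →
                 ∃[ a ] (isAt (P ++ κ x ∷ (M ++ κ y ∷ R)) z (h a) ≡ true)) →
              ∃[ w₁ ] ∃[ w ] ∃[ w₂ ] (P ≡ map κ w₁ × M ≡ map h w × R ≡ map κ w₂)
  preimages P M R u∈κ* between = proj₁ P′ , proj₁ M′ , proj₁ R′ , proj₂ P′ , proj₂ M′ , proj₂ R′
    where
    M∈h* : InImage h M
    M∈h* z z<M with between (suc (length P) + z) (s≤s (m≤m+n _ z)) (+-monoʳ-< (suc (length P)) z<M)
    ... | a , at-z = a , trans (sym (trans (isAt-after P (κ x) _ z (h a)) (isAt-++ˡ M _ z (h a) z<M))) at-z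
    P′ = InImage⇒map κ P (InImage-++ˡ κ P _ u∈κ*)
    M′ = InImage⇒map h M M∈h*
    R′ = InImage⇒map κ R (InImage-tail κ _ R (InImage-++ʳ κ M _ (InImage-tail κ _ _ (InImage-++ʳ κ P _ u∈κ*))))

  decompose : ∀ u i j → InImage κ u → i < j → isAt u i (κ x) ≡ true → isAt u j (κ y) ≡ true →
              (∀ z → i < z → z < j → ∃[ a ] (isAt u z (h a) ≡ true)) →
              ∃[ w₁ ] ∃[ w ] ∃[ w₂ ] (u ≡ Framed.U w₁ w w₂ × i ≡ Framed.i w₁ w w₂ × j ≡ Framed.j w₁ w w₂)
  decompose u i j u∈κ* i<j x-at-i y-at-j between with isAt⇒split u i (κ x) x-at-i
  ... | P , q , refl , refl with m≤n⇒∃[o]m+o≡n i<j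
  ... | t , refl with isAt⇒split q t (κ y) (trans (sym (isAt-after P (κ x) q t (κ y))) y-at-j)
  ... | M , R , refl , refl with preimages P M R u∈κ* between
  ... | w₁ , w , w₂ , refl , refl , refl =
    w₁ , w , w₂ , refl , refl , cong (suc (length (map κ w₁)) +_) (length-map h w)

  factor-parts : ∀ φ u i j → evalℕ u (Factor′ φ) (positions i j) ≡ true →
                 i < j × isAt u i (κ x) ≡ true × isAt u j (κ y) ≡ true ×
                 evalℕ u OnlyΣBetween′ (positions i j) ≡ true ×
                 evalℕ u (relativise φ (λ ()) (fs fz) fz) (positions i j) ≡ true
  factor-parts φ u i j f =
    <ᵇ≡true⇒< (∧-elimˡ f) , ∧-elimˡ f₁ , ∧-elimˡ f₂ , ∧-elimˡ f₃ , ∧-elimʳ {evalℕ u OnlyΣBetween′ (positions i j)} f₃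
    where
    f₁ = ∧-elimʳ {i <ᵇ j} f
    f₂ = ∧-elimʳ {isAt u i (κ x)} f₁
    f₃ = ∧-elimʳ {isAt u j (κ y)} f₂

  module _ (φ : FS 0) (φ-sem : ∀ w → L w ⇔ evalℕ w φ ρ₀ ≡ true) where

    frame-complete : ∀ u → L′ ι κ x y L u → evalℕ u (frame φ) ρ₀ ≡ true
    frame-complete u (w₁ , w , w₂ , Lw , refl) rewrite map-framed w₁ w w₂ =
      ∧-intro (any<-intro (length U) i (<-trans (s≤s (m≤m+n i (length w))) j<U)
                 (any<-intro (length U) j j<U (factor-holds φ (to (φ-sem w) Lw))))
              (from (OnlyΓ-sem U) (subst (InImage κ) (map-framed w₁ w w₂) (InImage-map κ (w₁ ++ x ∷ (map ι w ++ y ∷ w₂)))))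
      where
      open Framed w₁ w w₂
      j<U : j < length U
      j<U = isAt⇒<length U j (κ y) at-j

    frame-sound : ∀ u → evalℕ u (frame φ) ρ₀ ≡ true → L′ ι κ x y L u
    frame-sound u holds with any<-elim (length u) (∧-elimˡ holds)
    ... | i , _ , ∃j with any<-elim (length u) ∃j
    ... | j , j<u , factor with factor-parts φ u i j factor
    ... | i<j , x-at-i , y-at-j , onlyΣ , rel
      with decompose u i j (to (OnlyΓ-sem u) (∧-elimʳ {evalℕ u (∃′ (∃′ (Factor′ φ))) ρ₀} holds)) i<j x-at-i y-at-j
                     (λ z i<z z<j → to (OnlyΣBetween-sem u i j) onlyΣ z (<-trans z<j j<u) i<z z<j)
    ... | w₁ , w , w₂ , refl , refl , refl =
      w₁ , w , w₂ , from (φ-sem w) (trans (sym (Framed.relativise-framed w₁ w w₂ φ)) rel) , sym (map-framed w₁ w w₂)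

  frame-definable : Definable ℒ s L → Definable ℒ d (L′ ι κ x y L)
  frame-definable (φ , φ-def) = frame φ , λ u →
    subst (λ b → _ ⇔ b ≡ true) (sym (⊨≡evalℕ u (frame φ))) (mk⇔ (frame-complete φ φ-sem u) (frame-sound φ φ-sem u))
    where
    φ-sem : ∀ w → L w ⇔ evalℕ w φ ρ₀ ≡ true
    φ-sem w = subst (λ b → L w ⇔ b ≡ true) (⊨≡evalℕ w φ) (φ-def w)

lemma7 : (ℒ : Logic) (s g d : ℕ)
         (ι : Fin s → Fin g) (κ : Fin g → Fin d)
         → Injective _≡_ _≡_ ι → Injective _≡_ _≡_ κ
         → (x y : Fin g) → (∀ a → ι a ≢ x) → (∀ a → ι a ≢ y)
         → (L : Language s) → Regular s L
         → Definable ℒ s L ⇔ Definable ℒ d (L′ ι κ x y L)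
lemma7 ℒ s g d ι κ ι-inj κ-inj x y x∉ι y∉ι L _ = mk⇔ frame-definable unframe-definable
  where open Framing {ℒ} ι κ ι-inj κ-inj x y x∉ι y∉ι L
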